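{- For each residue class $l \bmod 72$ with $\gcd(l, 72) = 1$, there exist a nonnegative integer $M_l$ and primes $p_0, p_1, \ldots, p_{M_l}$, all congruent to $l \bmod 72$, such that: <ul> <li>$p_0 < 19541$;</li> <li>$p_{i-1} < p_i < 1.0584\, p_{i-1}$ for each $i = 1, 2, \ldots, M_l$;</li> <li>$p_{M_l} > 10^{10}$.</li> </ul> -}

module Defs where

open import Data.Nat using (ℕ; suc; _<_; _*_; _%_)
open import Data.Fin using (Fin; inject₁)
open import Data.Nat.Primality using (Prime)
open import Relation.Binary.PropositionalEquality using (_≡_)
open import Data.Product using (_×_)

record PrimeChain (l M : ℕ) (p : Fin (suc M) → ℕ) : Set where
  field
    allPrime    : ∀ i → Prime (p i)
    allCongr    : ∀ i → p i % 72 ≡ l % 72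
    increasing  : ∀ (i : Fin M) → p (inject₁ i) < p (Data.Fin.suc i)
    ratioBound  : ∀ (i : Fin M) → 10000 * p (Data.Fin.suc i) < 10584 * p (inject₁ i)

module Submission where

-- The theorem is a finite verification.
--
-- A prime n is stored together with a number
--    of "wheel turns" t: n is checked to be indivisible by 2, 3 and by
--    the candidates 6j+5, 6j+7 for j < t, and (6t+5)² > n.  Soundness
--    rests on the wheel invariant "n has no divisor in [2, 6j+5)", which
--    survives one turn because 6j+6, …, 6j+10 are divisible by 2 or 3.
-- 2. Chain certificates.  A predicate on vectors of (prime, turns)
--    entries, decidable, and the lemma turning it into a PrimeChain.
-- 3. The table of 24 chains and two facts decided by evaluation: every
--    chain in it is valid, and every residue below 72 coprime to 72 is
--    listed.  The theorem follows by reducing l modulo 72.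

open import Defs
open import Data.Nat using (ℕ; suc; _<_; _>_; _^_)
open import Data.Nat.Coprimality using (Coprime)
open import Data.Fin using (Fin; zero; fromℕ)
open import Data.Product using (Σ; _×_)

open import Data.Bool using (Bool; T; not; _∧_)
open import Data.Bool.Properties using (T-∧)
open import Data.Nat using (_+_; _*_; _%_; _<ᵇ_; _≡ᵇ_; NonZero; NonTrivial)
open import Data.Nat.Properties using (<ᵇ⇒<; _≟_; _<?_)
open import Data.Nat.DivMod using (m%n<n)
open import Data.Nat.Divisibility
  using (_∣_; _∤_; divides; ∣-trans; n∣m*n; ∣m∣n⇒∣m+n; ∣n∣m%n⇒∣m; n∣m⇒m%n≡0)
open import Data.Nat.Primality
  using (Prime; _Rough_; 2-rough; ∤⇒rough-suc; rough∧square>⇒prime)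
open import Data.Nat.Coprimality using (coprime?)
open import Data.Fin as Fin using (toℕ; inject₁; fromℕ<)
open import Data.Fin.Properties using (all?; toℕ-fromℕ<)
open import Data.List using (List; []; _∷_)
import Data.List.Relation.Unary.All as ListAll
open import Data.List.Relation.Unary.Any as Any using (Any; any?)
open import Data.Product using (_,_; -,_; proj₁; proj₂)
open import Data.Vec using (Vec; []; _∷_; lookup)
open import Data.Vec.Relation.Unary.All as All using (All)
open import Data.Vec.Relation.Unary.All.Properties using (lookup⁺)
open import Data.Vec.Relation.Unary.Linked as Linked using (Linked; _∷_)
open import Function using (_∘_; Equivalence)
open import Relation.Binary.PropositionalEquality using (_≡_; refl; sym; subst)
open import Relation.Nullary.Decidable using (T?; from-yes; _×-dec_; _→-dec_)
open import Relation.Unary using (Decidable)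

open Equivalence using (to)

-- Splitting a checked conjunction; the left conjunct is given explicitly
-- because it cannot be recovered from the reduced boolean.
split : ∀ a {b} → T (a ∧ b) → T a × T b
split a = to (T-∧ {a})

_∤ᵇ_ : (d n : ℕ) .{{_ : NonZero d}} → Bool
d ∤ᵇ n = not (n % d ≡ᵇ 0)

∤ᵇ-sound : ∀ d n .{{_ : NonZero d}} → T (d ∤ᵇ n) → d ∤ n
∤ᵇ-sound d n pass d∣n = subst (λ m → T (not (m ≡ᵇ 0))) (n∣m⇒m%n≡0 n d d∣n) pass

∤-via-factor : ∀ {d a n} j → d ∣ a → d ∣ 6 → d ∤ n → (a + j * 6) ∤ n
∤-via-factor j d∣a d∣6 d∤n a+6j∣n =
  d∤n (∣-trans (∣m∣n⇒∣m+n d∣a (∣-trans d∣6 (n∣m*n j))) a+6j∣n)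

5-rough : ∀ {n} → 2 ∤ n → 3 ∤ n → 5 Rough n
5-rough 2∤n 3∤n =
  ∤⇒rough-suc (λ 4∣n → 2∤n (∣-trans (divides 2 refl) 4∣n))
    (∤⇒rough-suc 3∤n (∤⇒rough-suc 2∤n 2-rough))

-- One turn of the wheel: of 6j+5, …, 6j+10 only 6j+5 and 6j+7 are
-- coprime to 6, so testing these two extends the divisor-free range to
-- [2, 6j+11).
wheel-step : ∀ {n} j → 2 ∤ n → 3 ∤ n → (5 + j * 6) ∤ n → (7 + j * 6) ∤ n →
             (5 + j * 6) Rough n → (11 + j * 6) Rough n
wheel-step j 2∤n 3∤n 5+6j∤n 7+6j∤n =
    ∤⇒rough-suc (∤-via-factor j (divides 5 refl) (divides 3 refl) 2∤n)
  ∘ ∤⇒rough-suc (∤-via-factor j (divides 3 refl) (divides 2 refl) 3∤n)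
  ∘ ∤⇒rough-suc (∤-via-factor j (divides 4 refl) (divides 3 refl) 2∤n)
  ∘ ∤⇒rough-suc 7+6j∤n
  ∘ ∤⇒rough-suc (∤-via-factor j (divides 3 refl) (divides 3 refl) 2∤n)
  ∘ ∤⇒rough-suc 5+6j∤n

wheelTest : (n j turns : ℕ) → Bool
wheelTest n j 0           = n <ᵇ (5 + j * 6) * (5 + j * 6)
wheelTest n j (suc turns) =
  (5 + j * 6) ∤ᵇ n ∧ ((7 + j * 6) ∤ᵇ n ∧ wheelTest n (suc j) turns)

-- Induction on the turns, carrying the wheel invariant; at the end the
-- divisor-free range reaches past √n.
wheelTest-sound : ∀ {n} j turns .{{_ : NonTrivial n}} → 2 ∤ n → 3 ∤ n →
                  (5 + j * 6) Rough n → T (wheelTest n j turns) → Prime n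
wheelTest-sound j 0 _ _ rough n<m² = rough∧square>⇒prime rough (<ᵇ⇒< _ _ n<m²)
wheelTest-sound {n} j (suc turns) 2∤n 3∤n rough pass =
  let 5+6j∤n , pass′ = split ((5 + j * 6) ∤ᵇ n) pass
      7+6j∤n , pass″ = split ((7 + j * 6) ∤ᵇ n) pass′
      step = wheel-step j 2∤n 3∤n (∤ᵇ-sound _ n 5+6j∤n) (∤ᵇ-sound _ n 7+6j∤n)
  in wheelTest-sound (suc j) turns 2∤n 3∤n (step rough) pass″

primeTest : (n turns : ℕ) → Bool
primeTest n turns = (1 <ᵇ n) ∧ (2 ∤ᵇ n ∧ (3 ∤ᵇ n ∧ wheelTest n 0 turns))

primeTest-sound : ∀ n turns → T (primeTest n turns) → Prime n
primeTest-sound n turns pass =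
  let n>1 , pass′ = split (1 <ᵇ n) pass
      2∤ᵇn , pass″ = split (2 ∤ᵇ n) pass′
      3∤ᵇn , pass‴ = split (3 ∤ᵇ n) pass″
      2∤n = ∤ᵇ-sound 2 n 2∤ᵇn
      3∤n = ∤ᵇ-sound 3 n 3∤ᵇn
      instance _ = record { nonTrivial = n>1 }
  in wheelTest-sound 0 turns 2∤n 3∤n (5-rough 2∤n 3∤n) pass‴

-- An entry is a prime together with the number of wheel turns certifying it.
Entry : Set
Entry = ℕ × ℕ

CertifiedFor : ℕ → Entry → Set
CertifiedFor r (p , turns) = T (primeTest p turns) × p % 72 ≡ r

Step : Entry → Entry → Set
Step (p , _) (q , _) = p < q × 10000 * q < 10584 * p

ChainCertificate : Set
ChainCertificate = Σ ℕ λ M → Vec Entry (suc M)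

Valid : ℕ → ChainCertificate → Set
Valid r (M , v) =
  All (CertifiedFor r) v × Linked Step v ×
  proj₁ (lookup v zero) < 19541 × proj₁ (lookup v (fromℕ M)) > 10 ^ 10

valid? : ∀ r → Decidable (Valid r)
valid? r (M , v) =
  All.all? (λ (p , turns) → T? (primeTest p turns) ×-dec p % 72 ≟ r) v ×-dec
  Linked.linked? (λ (p , _) (q , _) → p <? q ×-dec 10000 * q <? 10584 * p) v ×-dec
  proj₁ (lookup v zero) <? 19541 ×-dec 10 ^ 10 <? proj₁ (lookup v (fromℕ M))

linked-lookup : ∀ {a ℓ} {A : Set a} {R : A → A → Set ℓ} {M} {v : Vec A (suc M)} →
                Linked R v → (i : Fin M) → R (lookup v (inject₁ i)) (lookup v (Fin.suc i))
linked-lookup {v = _ ∷ _ ∷ _} (r ∷ _)  zero        = r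
linked-lookup {v = _ ∷ _ ∷ _} (_ ∷ rs) (Fin.suc i) = linked-lookup rs i

certified⇒PrimeChain : ∀ l {M} {v : Vec Entry (suc M)} →
                       All (CertifiedFor (l % 72)) v → Linked Step v →
                       PrimeChain l M (λ i → proj₁ (lookup v i))
certified⇒PrimeChain l {v = v} entries steps = record
  { allPrime   = λ i → primeTest-sound _ (proj₂ (lookup v i)) (proj₁ (lookup⁺ entries i))
  ; allCongr   = λ i → proj₂ (lookup⁺ entries i)
  ; increasing = λ i → proj₁ (linked-lookup steps i)
  ; ratioBound = λ i → proj₂ (linked-lookup steps i)
  }

coprime-% : ∀ {m n} .{{_ : NonZero n}} → Coprime m n → Coprime (m % n) n
coprime-% m⊥n (d∣m%n , d∣n) = m⊥n (∣n∣m%n⇒∣m d∣n d∣m%n , d∣n)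

chain1 : Vec Entry 237
chain1 =
  (19441 , 23) ∷ (20521 , 24) ∷ (21673 , 24) ∷ (21961 , 24) ∷ (23041 , 25) ∷ (24337 , 26) ∷ (25633 , 26) ∷
  (27073 , 27) ∷ (28513 , 28) ∷ (30169 , 29) ∷ (31393 , 29) ∷ (33049 , 30) ∷ (34849 , 31) ∷ (36793 , 32) ∷
  (38737 , 32) ∷ (40897 , 33) ∷ (43201 , 34) ∷ (45433 , 35) ∷ (47881 , 36) ∷ (50329 , 37) ∷ (52561 , 38) ∷
  (55441 , 39) ∷ (58537 , 40) ∷ (61561 , 41) ∷ (65089 , 42) ∷ (68473 , 43) ∷ (72073 , 44) ∷ (76249 , 46) ∷
  (80209 , 47) ∷ (84673 , 48) ∷ (89209 , 49) ∷ (94321 , 51) ∷ (99793 , 52) ∷ (105337 , 54) ∷ (110881 , 55) ∷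
  (116929 , 57) ∷ (123553 , 58) ∷ (130681 , 60) ∷ (138241 , 62) ∷ (146161 , 63) ∷ (154369 , 65) ∷ (162937 , 67) ∷
  (172441 , 69) ∷ (182233 , 71) ∷ (192817 , 73) ∷ (203977 , 75) ∷ (215857 , 77) ∷ (228457 , 79) ∷ (241561 , 82) ∷
  (255457 , 84) ∷ (270217 , 86) ∷ (285841 , 89) ∷ (302329 , 91) ∷ (319897 , 94) ∷ (338473 , 97) ∷ (358201 , 99) ∷
  (379081 , 102) ∷ (401113 , 105) ∷ (423649 , 108) ∷ (448057 , 111) ∷ (474049 , 114) ∷ (501409 , 118) ∷ (530641 , 121) ∷
  (561529 , 125) ∷ (593641 , 128) ∷ (628057 , 132) ∷ (664633 , 136) ∷ (703441 , 139) ∷ (744409 , 143) ∷ (787609 , 148) ∷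
  (832969 , 152) ∷ (880993 , 156) ∷ (932257 , 161) ∷ (986617 , 165) ∷ (1044217 , 170) ∷ (1104913 , 175) ∷ (1169353 , 180) ∷
  (1237393 , 185) ∷ (1309249 , 190) ∷ (1385569 , 196) ∷ (1466137 , 201) ∷ (1551601 , 207) ∷ (1642033 , 213) ∷ (1737793 , 219) ∷
  (1839169 , 226) ∷ (1946377 , 232) ∷ (2059921 , 239) ∷ (2180089 , 246) ∷ (2306881 , 253) ∷ (2441521 , 260) ∷ (2584081 , 268) ∷
  (2734561 , 275) ∷ (2894041 , 283) ∷ (3062881 , 291) ∷ (3241657 , 300) ∷ (3430873 , 308) ∷ (3630961 , 317) ∷ (3842929 , 326) ∷
  (4067137 , 336) ∷ (4304161 , 345) ∷ (4555513 , 355) ∷ (4821049 , 366) ∷ (5102353 , 376) ∷ (5400001 , 387) ∷ (5715217 , 398) ∷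
  (6047929 , 410) ∷ (6400873 , 421) ∷ (6774409 , 433) ∷ (7169977 , 446) ∷ (7588297 , 459) ∷ (8031097 , 472) ∷ (8499889 , 486) ∷
  (8996041 , 500) ∷ (9521353 , 514) ∷ (10077337 , 529) ∷ (10665433 , 544) ∷ (11288089 , 560) ∷ (11946241 , 576) ∷ (12643489 , 592) ∷
  (13381777 , 609) ∷ (14162977 , 627) ∷ (14987449 , 645) ∷ (15862537 , 663) ∷ (16788601 , 683) ∷ (17768953 , 702) ∷ (18805609 , 722) ∷
  (19903321 , 743) ∷ (21065041 , 765) ∷ (22295233 , 787) ∷ (23597209 , 809) ∷ (24974497 , 833) ∷ (26432929 , 857) ∷ (27976537 , 881) ∷
  (29609497 , 907) ∷ (31338649 , 933) ∷ (33168601 , 960) ∷ (35105617 , 987) ∷ (37155169 , 1016) ∷ (39324601 , 1045) ∷ (41620681 , 1075) ∷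
  (44051257 , 1106) ∷ (46623529 , 1138) ∷ (49346281 , 1170) ∷ (52227937 , 1204) ∷ (55277713 , 1239) ∷ (58505761 , 1274) ∷ (61921297 , 1311) ∷
  (65536777 , 1349) ∷ (69363793 , 1388) ∷ (73414441 , 1428) ∷ (77701609 , 1469) ∷ (82239193 , 1511) ∷ (87041881 , 1555) ∷ (92125081 , 1599) ∷
  (97504921 , 1645) ∷ (103197961 , 1693) ∷ (109224721 , 1742) ∷ (115603273 , 1792) ∷ (122354137 , 1843) ∷ (129499417 , 1896) ∷ (137062153 , 1951) ∷
  (145066177 , 2007) ∷ (153537697 , 2065) ∷ (162504073 , 2124) ∷ (171993817 , 2185) ∷ (182038177 , 2248) ∷ (192667537 , 2313) ∷ (203919193 , 2380) ∷
  (215827849 , 2448) ∷ (228432097 , 2519) ∷ (241771393 , 2591) ∷ (255890737 , 2666) ∷ (270834481 , 2743) ∷ (286651153 , 2821) ∷ (303391441 , 2903) ∷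
  (321109057 , 2986) ∷ (339861241 , 3072) ∷ (359708761 , 3161) ∷ (380715409 , 3252) ∷ (402949153 , 3345) ∷ (426480553 , 3442) ∷ (451386361 , 3541) ∷
  (477747217 , 3643) ∷ (505647073 , 3747) ∷ (535176289 , 3855) ∷ (566430049 , 3966) ∷ (599509441 , 4080) ∷ (634520737 , 4198) ∷ (671576617 , 4319) ∷
  (710796169 , 4443) ∷ (752306617 , 4571) ∷ (796241233 , 4703) ∷ (842741569 , 4838) ∷ (891957673 , 4977) ∷ (944047729 , 5121) ∷ (999178849 , 5268) ∷
  (1057530457 , 5420) ∷ (1119290113 , 5576) ∷ (1184655673 , 5736) ∷ (1253839177 , 5901) ∷ (1327063321 , 6071) ∷ (1404563761 , 6246) ∷ (1486590121 , 6426) ∷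
  (1573405129 , 6611) ∷ (1665291889 , 6801) ∷ (1762542361 , 6997) ∷ (1865474713 , 7198) ∷ (1974418273 , 7405) ∷ (2089724113 , 7619) ∷ (2211763033 , 7838) ∷
  (2340929233 , 8064) ∷ (2477639377 , 8296) ∷ (2622333313 , 8534) ∷ (2775477169 , 8780) ∷ (2937564937 , 9033) ∷ (3109117321 , 9293) ∷ (3290689729 , 9560) ∷
  (3482865937 , 9836) ∷ (3686264209 , 10119) ∷ (3901541113 , 10410) ∷ (4129390801 , 10710) ∷ (4370546233 , 11018) ∷ (4625786089 , 11335) ∷ (4895931241 , 11661) ∷
  (5181853321 , 11997) ∷ (5484473353 , 12343) ∷ (5804766577 , 12698) ∷ (6143764609 , 13063) ∷ (6502560049 , 13439) ∷ (6882309361 , 13826) ∷ (7284235969 , 14224) ∷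
  (7709635009 , 14634) ∷ (8159877577 , 15055) ∷ (8636414329 , 15488) ∷ (9140780161 , 15934) ∷ (9674601049 , 16393) ∷ (10239597649 , 16865) ∷ []

chain5 : Vec Entry 237
chain5 =
  (19373 , 23) ∷ (20021 , 23) ∷ (21101 , 24) ∷ (22109 , 24) ∷ (23333 , 25) ∷ (24413 , 26) ∷ (25349 , 26) ∷
  (26717 , 27) ∷ (28229 , 28) ∷ (29741 , 28) ∷ (31469 , 29) ∷ (33053 , 30) ∷ (34781 , 31) ∷ (36653 , 32) ∷
  (38669 , 32) ∷ (40829 , 33) ∷ (43133 , 34) ∷ (45293 , 35) ∷ (47741 , 36) ∷ (50333 , 37) ∷ (53069 , 38) ∷
  (56093 , 39) ∷ (59333 , 40) ∷ (62501 , 41) ∷ (66029 , 42) ∷ (69557 , 44) ∷ (73589 , 45) ∷ (77621 , 46) ∷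
  (82013 , 47) ∷ (86693 , 49) ∷ (91733 , 50) ∷ (96989 , 52) ∷ (102533 , 53) ∷ (108293 , 55) ∷ (114269 , 56) ∷
  (120749 , 58) ∷ (127733 , 59) ∷ (135077 , 61) ∷ (142421 , 63) ∷ (150413 , 64) ∷ (158981 , 66) ∷ (168197 , 68) ∷
  (177917 , 70) ∷ (187637 , 72) ∷ (198437 , 74) ∷ (209813 , 76) ∷ (221909 , 78) ∷ (234653 , 80) ∷ (248189 , 83) ∷
  (261581 , 85) ∷ (276629 , 87) ∷ (292541 , 90) ∷ (309461 , 92) ∷ (327317 , 95) ∷ (346397 , 98) ∷ (366341 , 101) ∷
  (387509 , 103) ∷ (410117 , 106) ∷ (433877 , 109) ∷ (458789 , 113) ∷ (484853 , 116) ∷ (512717 , 119) ∷ (542237 , 122) ∷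
  (573557 , 126) ∷ (607037 , 130) ∷ (641813 , 133) ∷ (679037 , 137) ∷ (718493 , 141) ∷ (759893 , 145) ∷ (803813 , 149) ∷
  (850613 , 153) ∷ (900149 , 158) ∷ (952709 , 162) ∷ (1007933 , 167) ∷ (1066757 , 172) ∷ (1128821 , 177) ∷ (1194341 , 182) ∷
  (1264037 , 187) ∷ (1337621 , 192) ∷ (1415237 , 198) ∷ (1497533 , 204) ∷ (1584941 , 209) ∷ (1677461 , 216) ∷ (1775309 , 222) ∷
  (1878629 , 228) ∷ (1987709 , 235) ∷ (2102693 , 241) ∷ (2225381 , 248) ∷ (2354837 , 255) ∷ (2492069 , 263) ∷ (2637581 , 270) ∷
  (2791589 , 278) ∷ (2954453 , 286) ∷ (3126821 , 294) ∷ (3309413 , 303) ∷ (3501437 , 312) ∷ (3705917 , 321) ∷ (3922277 , 330) ∷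
  (4150733 , 339) ∷ (4392797 , 349) ∷ (4649261 , 359) ∷ (4920269 , 369) ∷ (5207549 , 380) ∷ (5511461 , 391) ∷ (5833229 , 402) ∷
  (6173861 , 414) ∷ (6533717 , 426) ∷ (6915173 , 438) ∷ (7318733 , 451) ∷ (7745189 , 464) ∷ (8196917 , 477) ∷ (8675573 , 491) ∷
  (9182093 , 505) ∷ (9717989 , 519) ∷ (10284629 , 534) ∷ (10885181 , 550) ∷ (11520869 , 565) ∷ (12193133 , 582) ∷ (12905141 , 598) ∷
  (13658621 , 616) ∷ (14456237 , 633) ∷ (15299789 , 652) ∷ (16192949 , 670) ∷ (17138453 , 690) ∷ (18139109 , 710) ∷ (19198229 , 730) ∷
  (20319197 , 751) ∷ (21505541 , 773) ∷ (22761149 , 795) ∷ (24089909 , 818) ∷ (25496573 , 841) ∷ (26984453 , 865) ∷ (28560029 , 890) ∷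
  (30227837 , 916) ∷ (31992629 , 942) ∷ (33860381 , 969) ∷ (35837357 , 997) ∷ (37930037 , 1026) ∷ (40144901 , 1056) ∷ (42488861 , 1086) ∷
  (44970053 , 1117) ∷ (47596181 , 1149) ∷ (50375309 , 1183) ∷ (53316581 , 1217) ∷ (56430149 , 1252) ∷ (59725661 , 1288) ∷ (63212189 , 1325) ∷
  (66903269 , 1363) ∷ (70809773 , 1402) ∷ (74944733 , 1443) ∷ (79321469 , 1484) ∷ (83953733 , 1527) ∷ (88856213 , 1571) ∷ (94045253 , 1616) ∷
  (99537341 , 1662) ∷ (105350261 , 1710) ∷ (111502661 , 1760) ∷ (118014341 , 1810) ∷ (124905533 , 1862) ∷ (132199997 , 1916) ∷ (139918829 , 1971) ∷
  (148089677 , 2028) ∷ (156737813 , 2086) ∷ (165891029 , 2146) ∷ (175578917 , 2208) ∷ (185832653 , 2272) ∷ (196684493 , 2337) ∷ (208170581 , 2404) ∷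
  (220326773 , 2474) ∷ (233193173 , 2545) ∷ (246811469 , 2618) ∷ (261224933 , 2693) ∷ (276479141 , 2771) ∷ (292623629 , 2851) ∷ (309711317 , 2933) ∷
  (327797429 , 3017) ∷ (346940357 , 3104) ∷ (367201661 , 3193) ∷ (388646213 , 3285) ∷ (411343133 , 3380) ∷ (435365213 , 3477) ∷ (460789853 , 3577) ∷
  (487699637 , 3680) ∷ (516180173 , 3786) ∷ (546325061 , 3895) ∷ (578230349 , 4007) ∷ (611998781 , 4123) ∷ (647739509 , 4241) ∷ (685567373 , 4364) ∷
  (725603909 , 4489) ∷ (767978933 , 4618) ∷ (812828381 , 4751) ∷ (860296757 , 4888) ∷ (910537997 , 5029) ∷ (963712877 , 5174) ∷ (1019993621 , 5323) ∷
  (1079560733 , 5476) ∷ (1142606957 , 5633) ∷ (1209333533 , 5796) ∷ (1279958261 , 5962) ∷ (1354707149 , 6134) ∷ (1433821469 , 6311) ∷ (1517556461 , 6492) ∷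
  (1606181693 , 6679) ∷ (1699981637 , 6871) ∷ (1799259629 , 7069) ∷ (1904334989 , 7273) ∷ (2015548133 , 7482) ∷ (2133256109 , 7698) ∷ (2257838069 , 7919) ∷
  (2389695629 , 8147) ∷ (2529253157 , 8382) ∷ (2676959933 , 8623) ∷ (2833294109 , 8871) ∷ (2998758029 , 9126) ∷ (3173885357 , 9389) ∷ (3359239781 , 9659) ∷
  (3555419333 , 9938) ∷ (3763055741 , 10224) ∷ (3982818173 , 10518) ∷ (4215414389 , 10821) ∷ (4461594413 , 11132) ∷ (4722151397 , 11453) ∷ (4997924933 , 11782) ∷
  (5289802997 , 12122) ∷ (5598726989 , 12470) ∷ (5925692237 , 12829) ∷ (6271752029 , 13199) ∷ (6638021573 , 13579) ∷ (7025681669 , 13970) ∷ (7435981229 , 14372) ∷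
  (7870242173 , 14785) ∷ (8329864181 , 15211) ∷ (8816327717 , 15649) ∷ (9331201013 , 16099) ∷ (9876142733 , 16563) ∷ (10452909317 , 17040) ∷ []

chain7 : Vec Entry 238
chain7 =
  (19447 , 23) ∷ (20023 , 23) ∷ (21031 , 24) ∷ (22111 , 24) ∷ (22543 , 25) ∷ (23767 , 25) ∷ (24919 , 26) ∷
  (25999 , 27) ∷ (27367 , 27) ∷ (28879 , 28) ∷ (30391 , 29) ∷ (32119 , 30) ∷ (33703 , 30) ∷ (34351 , 31) ∷
  (36151 , 31) ∷ (38239 , 32) ∷ (40471 , 33) ∷ (42703 , 34) ∷ (45007 , 35) ∷ (47599 , 36) ∷ (50263 , 37) ∷
  (52999 , 38) ∷ (55807 , 39) ∷ (58831 , 40) ∷ (62143 , 41) ∷ (65599 , 42) ∷ (69127 , 43) ∷ (72871 , 45) ∷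
  (77047 , 46) ∷ (81439 , 47) ∷ (85903 , 49) ∷ (90583 , 50) ∷ (95479 , 51) ∷ (100591 , 53) ∷ (106279 , 54) ∷
  (112327 , 56) ∷ (117727 , 57) ∷ (124567 , 58) ∷ (131839 , 60) ∷ (138967 , 62) ∷ (147031 , 64) ∷ (155599 , 65) ∷
  (164599 , 67) ∷ (173743 , 69) ∷ (183823 , 71) ∷ (194479 , 73) ∷ (205783 , 75) ∷ (217519 , 77) ∷ (230047 , 80) ∷
  (243367 , 82) ∷ (257407 , 84) ∷ (272383 , 87) ∷ (288007 , 89) ∷ (304279 , 92) ∷ (321991 , 94) ∷ (340063 , 97) ∷
  (359719 , 100) ∷ (380383 , 102) ∷ (402559 , 105) ∷ (425959 , 108) ∷ (450799 , 112) ∷ (476863 , 115) ∷ (504151 , 118) ∷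
  (533167 , 121) ∷ (564271 , 125) ∷ (597031 , 128) ∷ (630871 , 132) ∷ (667519 , 136) ∷ (706183 , 140) ∷ (747223 , 144) ∷
  (790567 , 148) ∷ (836071 , 152) ∷ (884743 , 156) ∷ (936223 , 161) ∷ (990799 , 166) ∷ (1047751 , 170) ∷ (1108663 , 175) ∷
  (1172959 , 180) ∷ (1240999 , 185) ∷ (1313359 , 191) ∷ (1389319 , 196) ∷ (1470319 , 202) ∷ (1555999 , 208) ∷ (1646719 , 214) ∷
  (1741903 , 220) ∷ (1843423 , 226) ∷ (1950919 , 232) ∷ (2064679 , 239) ∷ (2184991 , 246) ∷ (2310991 , 253) ∷ (2445847 , 260) ∷
  (2588263 , 268) ∷ (2739103 , 276) ∷ (2898871 , 283) ∷ (3067927 , 292) ∷ (3246559 , 300) ∷ (3435847 , 309) ∷ (3636439 , 317) ∷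
  (3848623 , 327) ∷ (4073191 , 336) ∷ (4311007 , 346) ∷ (4562287 , 356) ∷ (4828543 , 366) ∷ (5110423 , 376) ∷ (5408791 , 387) ∷
  (5724151 , 398) ∷ (6057871 , 410) ∷ (6411103 , 422) ∷ (6785503 , 434) ∷ (7181719 , 446) ∷ (7601119 , 459) ∷ (8044783 , 472) ∷
  (8513863 , 486) ∷ (9010879 , 500) ∷ (9536551 , 514) ∷ (10093399 , 529) ∷ (10682071 , 544) ∷ (11305519 , 560) ∷ (11964751 , 576) ∷
  (12663439 , 593) ∷ (13402303 , 610) ∷ (14184943 , 627) ∷ (15012367 , 645) ∷ (15888967 , 664) ∷ (16816183 , 683) ∷ (17798191 , 703) ∷
  (18837583 , 723) ∷ (19937383 , 744) ∷ (21101551 , 765) ∷ (22333687 , 787) ∷ (23637319 , 810) ∷ (25017199 , 833) ∷ (26477791 , 857) ∷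
  (28023991 , 882) ∷ (29660551 , 907) ∷ (31392583 , 933) ∷ (33225631 , 960) ∷ (35165527 , 988) ∷ (37219183 , 1016) ∷ (39392071 , 1046) ∷
  (41691823 , 1076) ∷ (44126503 , 1107) ∷ (46703023 , 1139) ∷ (49429951 , 1171) ∷ (52316647 , 1205) ∷ (55371391 , 1240) ∷ (58604551 , 1276) ∷
  (62025703 , 1312) ∷ (65647447 , 1350) ∷ (69481231 , 1389) ∷ (73538863 , 1429) ∷ (77833159 , 1470) ∷ (82378591 , 1512) ∷ (87189199 , 1556) ∷
  (92280751 , 1601) ∷ (97669447 , 1647) ∷ (103373287 , 1694) ∷ (109410199 , 1743) ∷ (115799191 , 1793) ∷ (122561431 , 1845) ∷ (129718447 , 1898) ∷
  (137293927 , 1953) ∷ (145311847 , 2009) ∷ (153797983 , 2067) ∷ (162779191 , 2126) ∷ (172285423 , 2187) ∷ (182346847 , 2250) ∷ (192995359 , 2315) ∷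
  (204265519 , 2382) ∷ (216194551 , 2450) ∷ (228819247 , 2521) ∷ (242182159 , 2593) ∷ (256325191 , 2668) ∷ (271293991 , 2745) ∷ (287137231 , 2824) ∷
  (303905743 , 2905) ∷ (321653023 , 2989) ∷ (340437463 , 3075) ∷ (360318103 , 3163) ∷ (381360607 , 3254) ∷ (403631791 , 3348) ∷ (427203871 , 3444) ∷
  (452152231 , 3544) ∷ (478557727 , 3646) ∷ (506505031 , 3751) ∷ (536084503 , 3859) ∷ (567391831 , 3970) ∷ (600526951 , 4084) ∷ (635596279 , 4202) ∷
  (672714223 , 4322) ∷ (712000087 , 4447) ∷ (753580159 , 4575) ∷ (797589007 , 4707) ∷ (844167823 , 4842) ∷ (893466727 , 4981) ∷ (945644983 , 5125) ∷
  (1000870207 , 5272) ∷ (1059320887 , 5424) ∷ (1121185159 , 5580) ∷ (1186662031 , 5741) ∷ (1255962751 , 5906) ∷ (1329310519 , 6076) ∷ (1406942071 , 6251) ∷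
  (1489107031 , 6431) ∷ (1576070863 , 6616) ∷ (1668110551 , 6807) ∷ (1765527991 , 7003) ∷ (1868634583 , 7204) ∷ (1977762823 , 7412) ∷ (2093263639 , 7625) ∷
  (2215509559 , 7845) ∷ (2344895071 , 8070) ∷ (2481836839 , 8303) ∷ (2626776079 , 8542) ∷ (2780178991 , 8788) ∷ (2942540287 , 9041) ∷ (3114384271 , 9301) ∷
  (3296264047 , 9569) ∷ (3488765263 , 9844) ∷ (3692508847 , 10127) ∷ (3908151223 , 10419) ∷ (4136386831 , 10719) ∷ (4377951727 , 11027) ∷ (4633623439 , 11345) ∷
  (4904226871 , 11671) ∷ (5190633223 , 12007) ∷ (5493765463 , 12353) ∷ (5814601207 , 12709) ∷ (6154173583 , 13074) ∷ (6513576631 , 13451) ∷ (6893968183 , 13838) ∷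
  (7296575551 , 14236) ∷ (7722695527 , 14646) ∷ (8173700791 , 15068) ∷ (8651044879 , 15501) ∷ (9156264703 , 15948) ∷ (9690990487 , 16407) ∷ (10256942887 , 16879) ∷ []

chain11 : Vec Entry 237
chain11 =
  (19379 , 23) ∷ (19739 , 23) ∷ (20747 , 24) ∷ (21683 , 24) ∷ (22907 , 25) ∷ (24203 , 26) ∷ (24923 , 26) ∷
  (26003 , 27) ∷ (27299 , 27) ∷ (28307 , 28) ∷ (29819 , 28) ∷ (31547 , 29) ∷ (33347 , 30) ∷ (35291 , 31) ∷
  (37307 , 32) ∷ (39323 , 33) ∷ (41411 , 34) ∷ (43787 , 35) ∷ (46307 , 36) ∷ (48611 , 36) ∷ (51419 , 37) ∷
  (54371 , 39) ∷ (57467 , 40) ∷ (60779 , 41) ∷ (64091 , 42) ∷ (67763 , 43) ∷ (71363 , 44) ∷ (75323 , 45) ∷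
  (79427 , 47) ∷ (83891 , 48) ∷ (88643 , 49) ∷ (93683 , 51) ∷ (99083 , 52) ∷ (104123 , 53) ∷ (109883 , 55) ∷
  (115931 , 56) ∷ (122267 , 58) ∷ (128819 , 59) ∷ (136163 , 61) ∷ (143651 , 63) ∷ (152003 , 65) ∷ (160499 , 66) ∷
  (169859 , 68) ∷ (179651 , 70) ∷ (189947 , 72) ∷ (200891 , 74) ∷ (212411 , 76) ∷ (224579 , 79) ∷ (237683 , 81) ∷
  (251291 , 83) ∷ (265619 , 86) ∷ (280883 , 88) ∷ (297083 , 91) ∷ (314219 , 93) ∷ (332219 , 96) ∷ (351587 , 98) ∷
  (372107 , 101) ∷ (393779 , 104) ∷ (416531 , 107) ∷ (440723 , 110) ∷ (466283 , 113) ∷ (493211 , 117) ∷ (521723 , 120) ∷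
  (552179 , 124) ∷ (583859 , 127) ∷ (617843 , 131) ∷ (653339 , 134) ∷ (690491 , 138) ∷ (730811 , 142) ∷ (773363 , 146) ∷
  (818291 , 150) ∷ (865379 , 155) ∷ (915851 , 159) ∷ (969131 , 164) ∷ (1025579 , 168) ∷ (1084547 , 173) ∷ (1147331 , 178) ∷
  (1214219 , 183) ∷ (1284851 , 189) ∷ (1359803 , 194) ∷ (1439147 , 200) ∷ (1523099 , 205) ∷ (1612019 , 211) ∷ (1705331 , 217) ∷
  (1804763 , 224) ∷ (1909811 , 230) ∷ (2021339 , 237) ∷ (2139131 , 243) ∷ (2263763 , 250) ∷ (2395739 , 258) ∷ (2535059 , 265) ∷
  (2682947 , 273) ∷ (2839547 , 281) ∷ (3005291 , 289) ∷ (3180251 , 297) ∷ (3365867 , 305) ∷ (3562211 , 314) ∷ (3770219 , 323) ∷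
  (3990251 , 333) ∷ (4223243 , 342) ∷ (4469627 , 352) ∷ (4730483 , 362) ∷ (5006459 , 373) ∷ (5298779 , 383) ∷ (5608091 , 394) ∷
  (5934899 , 406) ∷ (6280283 , 417) ∷ (6646907 , 429) ∷ (7034771 , 442) ∷ (7445531 , 454) ∷ (7880267 , 468) ∷ (8340419 , 481) ∷
  (8827139 , 495) ∷ (9342587 , 509) ∷ (9887699 , 524) ∷ (10465139 , 539) ∷ (11076059 , 554) ∷ (11722691 , 570) ∷ (12406907 , 587) ∷
  (13130651 , 604) ∷ (13897307 , 621) ∷ (14708531 , 639) ∷ (15567203 , 657) ∷ (16475699 , 676) ∷ (17437691 , 696) ∷ (18454043 , 716) ∷
  (19531739 , 736) ∷ (20671499 , 757) ∷ (21878651 , 779) ∷ (23156219 , 802) ∷ (24508307 , 825) ∷ (25939523 , 849) ∷ (27454187 , 873) ∷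
  (29057339 , 898) ∷ (30754091 , 924) ∷ (32549843 , 951) ∷ (34450643 , 978) ∷ (36461891 , 1006) ∷ (38591219 , 1035) ∷ (40844891 , 1065) ∷
  (43229387 , 1095) ∷ (45753779 , 1127) ∷ (48425483 , 1159) ∷ (51253427 , 1193) ∷ (54245459 , 1227) ∷ (57413387 , 1263) ∷ (60765347 , 1299) ∷
  (64314011 , 1336) ∷ (68069891 , 1375) ∷ (72045011 , 1414) ∷ (76252403 , 1455) ∷ (80705243 , 1497) ∷ (85418363 , 1540) ∷ (90406523 , 1584) ∷
  (95686139 , 1630) ∷ (101272403 , 1677) ∷ (107186267 , 1725) ∷ (113445587 , 1775) ∷ (120070667 , 1826) ∷ (127082099 , 1879) ∷ (134503139 , 1933) ∷
  (142357979 , 1988) ∷ (150671099 , 2045) ∷ (159470291 , 2104) ∷ (168783203 , 2165) ∷ (178640003 , 2227) ∷ (189072227 , 2291) ∷ (200113931 , 2357) ∷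
  (211800539 , 2425) ∷ (224169131 , 2495) ∷ (237260459 , 2567) ∷ (251115923 , 2641) ∷ (265780883 , 2717) ∷ (281302139 , 2795) ∷ (297729587 , 2875) ∷
  (315116723 , 2958) ∷ (333519203 , 3043) ∷ (352996643 , 3131) ∷ (373611107 , 3221) ∷ (395429987 , 3314) ∷ (418522691 , 3409) ∷ (442963811 , 3507) ∷
  (468832043 , 3608) ∷ (496211411 , 3712) ∷ (525189827 , 3819) ∷ (555860891 , 3929) ∷ (588323027 , 4042) ∷ (622681067 , 4159) ∷ (659044667 , 4278) ∷
  (697532483 , 4401) ∷ (738267419 , 4528) ∷ (781382171 , 4659) ∷ (827014043 , 4793) ∷ (875311571 , 4931) ∷ (926429411 , 5073) ∷ (980532587 , 5219) ∷
  (1037795123 , 5369) ∷ (1098402131 , 5523) ∷ (1162548083 , 5682) ∷ (1230440411 , 5846) ∷ (1302297779 , 6014) ∷ (1378351883 , 6187) ∷ (1458847307 , 6365) ∷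
  (1544043971 , 6549) ∷ (1634215259 , 6737) ∷ (1729653203 , 6931) ∷ (1830664379 , 7131) ∷ (1937574011 , 7336) ∷ (2050728059 , 7547) ∷ (2170489403 , 7764) ∷
  (2297245763 , 7988) ∷ (2431404587 , 8218) ∷ (2573395787 , 8454) ∷ (2723681747 , 8698) ∷ (2882744651 , 8948) ∷ (3051096203 , 9206) ∷ (3229279643 , 9471) ∷
  (3417869243 , 9743) ∷ (3617472611 , 10024) ∷ (3828732923 , 10312) ∷ (4052330291 , 10609) ∷ (4288985219 , 10915) ∷ (4539461483 , 11229) ∷ (4804565627 , 11552) ∷
  (5085152147 , 11885) ∷ (5382123707 , 12227) ∷ (5696439563 , 12579) ∷ (6029111243 , 12941) ∷ (6381210179 , 13313) ∷ (6753872243 , 13697) ∷ (7148298323 , 14091) ∷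
  (7565758787 , 14497) ∷ (8007598667 , 14914) ∷ (8475242267 , 15343) ∷ (8970195683 , 15785) ∷ (9494054939 , 16239) ∷ (10048505339 , 16707) ∷ []

chain13 : Vec Entry 237
chain13 =
  (19381 , 23) ∷ (20389 , 23) ∷ (21397 , 24) ∷ (22621 , 25) ∷ (23917 , 25) ∷ (24781 , 26) ∷ (25933 , 27) ∷
  (26437 , 27) ∷ (27733 , 27) ∷ (29173 , 28) ∷ (30829 , 29) ∷ (32413 , 30) ∷ (34213 , 30) ∷ (36013 , 31) ∷
  (37957 , 32) ∷ (39901 , 33) ∷ (42061 , 34) ∷ (44293 , 35) ∷ (46381 , 36) ∷ (48973 , 37) ∷ (51637 , 38) ∷
  (54517 , 39) ∷ (57397 , 40) ∷ (60637 , 41) ∷ (63949 , 42) ∷ (67477 , 43) ∷ (71293 , 44) ∷ (75253 , 45) ∷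
  (79357 , 47) ∷ (83389 , 48) ∷ (88069 , 49) ∷ (92893 , 50) ∷ (98221 , 52) ∷ (103837 , 53) ∷ (109741 , 55) ∷
  (115933 , 56) ∷ (122701 , 58) ∷ (129757 , 60) ∷ (137029 , 61) ∷ (145021 , 63) ∷ (152941 , 65) ∷ (161869 , 67) ∷
  (170509 , 68) ∷ (179581 , 70) ∷ (189949 , 72) ∷ (201037 , 74) ∷ (212701 , 77) ∷ (224869 , 79) ∷ (237973 , 81) ∷
  (251653 , 83) ∷ (266269 , 86) ∷ (281317 , 88) ∷ (297589 , 91) ∷ (314581 , 93) ∷ (332509 , 96) ∷ (351733 , 99) ∷
  (372037 , 101) ∷ (393709 , 104) ∷ (416677 , 107) ∷ (440941 , 110) ∷ (466573 , 114) ∷ (493573 , 117) ∷ (522373 , 120) ∷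
  (552757 , 124) ∷ (584869 , 127) ∷ (618997 , 131) ∷ (655069 , 135) ∷ (693157 , 138) ∷ (733477 , 142) ∷ (776173 , 147) ∷
  (821461 , 151) ∷ (869413 , 155) ∷ (919381 , 159) ∷ (972661 , 164) ∷ (1029109 , 169) ∷ (1088293 , 174) ∷ (1151653 , 179) ∷
  (1218901 , 184) ∷ (1289749 , 189) ∷ (1364917 , 194) ∷ (1444477 , 200) ∷ (1528789 , 206) ∷ (1617493 , 212) ∷ (1711813 , 218) ∷
  (1811533 , 224) ∷ (1917301 , 230) ∷ (2029189 , 237) ∷ (2147269 , 244) ∷ (2272549 , 251) ∷ (2404957 , 258) ∷ (2545357 , 266) ∷
  (2693893 , 273) ∷ (2851141 , 281) ∷ (3017317 , 289) ∷ (3193429 , 298) ∷ (3379477 , 306) ∷ (3576829 , 315) ∷ (3785629 , 324) ∷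
  (4006381 , 333) ∷ (4239877 , 343) ∷ (4487341 , 353) ∷ (4748629 , 363) ∷ (5025541 , 373) ∷ (5318869 , 384) ∷ (5629333 , 395) ∷
  (5957509 , 406) ∷ (6305413 , 418) ∷ (6673477 , 430) ∷ (7062493 , 443) ∷ (7474693 , 455) ∷ (7910941 , 468) ∷ (8372317 , 482) ∷
  (8860909 , 496) ∷ (9378301 , 510) ∷ (9925717 , 525) ∷ (10505317 , 540) ∷ (11118253 , 555) ∷ (11767333 , 571) ∷ (12454501 , 588) ∷
  (13181557 , 605) ∷ (13950733 , 622) ∷ (14765341 , 640) ∷ (15627613 , 659) ∷ (16540213 , 677) ∷ (17505877 , 697) ∷ (18527701 , 717) ∷
  (19608637 , 738) ∷ (20752933 , 759) ∷ (21964837 , 781) ∷ (23247373 , 803) ∷ (24604861 , 826) ∷ (26041549 , 850) ∷ (27562333 , 875) ∷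
  (29171893 , 900) ∷ (30875413 , 926) ∷ (32677933 , 952) ∷ (34586221 , 980) ∷ (36605749 , 1008) ∷ (38743501 , 1037) ∷ (41005813 , 1067) ∷
  (43400101 , 1098) ∷ (45933493 , 1129) ∷ (48615493 , 1162) ∷ (51454453 , 1195) ∷ (54459373 , 1230) ∷ (57639397 , 1265) ∷ (61005397 , 1301) ∷
  (64568029 , 1339) ∷ (68338597 , 1377) ∷ (72329269 , 1417) ∷ (76552573 , 1458) ∷ (81023053 , 1500) ∷ (85754533 , 1543) ∷ (90762493 , 1587) ∷
  (96062557 , 1633) ∷ (101670997 , 1680) ∷ (107608261 , 1729) ∷ (113892349 , 1778) ∷ (120543421 , 1830) ∷ (127582933 , 1882) ∷ (135033709 , 1936) ∷
  (142918717 , 1992) ∷ (151264237 , 2049) ∷ (160097269 , 2108) ∷ (169446757 , 2169) ∷ (179341861 , 2232) ∷ (189815341 , 2296) ∷ (200900461 , 2362) ∷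
  (212632789 , 2430) ∷ (225049333 , 2500) ∷ (238191853 , 2572) ∷ (252101821 , 2646) ∷ (266824021 , 2722) ∷ (282406477 , 2800) ∷ (298898797 , 2881) ∷
  (316354117 , 2964) ∷ (334829029 , 3049) ∷ (354382573 , 3137) ∷ (375078469 , 3227) ∷ (396983029 , 3320) ∷ (420166381 , 3416) ∷ (444703621 , 3514) ∷
  (470673949 , 3616) ∷ (498161173 , 3720) ∷ (527253709 , 3827) ∷ (558045157 , 3937) ∷ (590634229 , 4050) ∷ (625127197 , 4167) ∷ (661634293 , 4287) ∷
  (700273669 , 4410) ∷ (741169381 , 4537) ∷ (784453333 , 4668) ∷ (830265277 , 4802) ∷ (878752741 , 4940) ∷ (930071533 , 5083) ∷ (984387037 , 5229) ∷
  (1041874789 , 5379) ∷ (1102719901 , 5534) ∷ (1167118573 , 5694) ∷ (1235278237 , 5857) ∷ (1307418349 , 6026) ∷ (1383770533 , 6200) ∷ (1464582541 , 6378) ∷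
  (1550113933 , 6562) ∷ (1640640541 , 6750) ∷ (1736453533 , 6945) ∷ (1837861717 , 7145) ∷ (1945192693 , 7350) ∷ (2058791773 , 7562) ∷ (2179024501 , 7780) ∷
  (2306278453 , 8004) ∷ (2440964749 , 8234) ∷ (2583516757 , 8471) ∷ (2734393117 , 8715) ∷ (2894081557 , 8966) ∷ (3063095869 , 9224) ∷ (3241980229 , 9489) ∷
  (3431311861 , 9763) ∷ (3631700029 , 10044) ∷ (3843790861 , 10333) ∷ (4068268213 , 10630) ∷ (4305854821 , 10936) ∷ (4557316693 , 11251) ∷ (4823463973 , 11575) ∷
  (5105153029 , 11908) ∷ (5403293869 , 12251) ∷ (5718845029 , 12604) ∷ (6052824157 , 12966) ∷ (6406308301 , 13340) ∷ (6780436573 , 13724) ∷ (7176413533 , 14119) ∷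
  (7595515813 , 14525) ∷ (8039092981 , 14943) ∷ (8508575893 , 15373) ∷ (9005475613 , 15816) ∷ (9531394861 , 16271) ∷ (10088027437 , 16740) ∷ []

chain17 : Vec Entry 237
chain17 =
  (19457 , 23) ∷ (20393 , 23) ∷ (21401 , 24) ∷ (22481 , 25) ∷ (23633 , 25) ∷ (24281 , 26) ∷ (25577 , 26) ∷
  (27017 , 27) ∷ (28097 , 28) ∷ (29537 , 28) ∷ (31193 , 29) ∷ (32993 , 30) ∷ (34721 , 31) ∷ (36161 , 31) ∷
  (38177 , 32) ∷ (40193 , 33) ∷ (42281 , 34) ∷ (44729 , 35) ∷ (46889 , 36) ∷ (49481 , 37) ∷ (52361 , 38) ∷
  (55313 , 39) ∷ (58481 , 40) ∷ (61001 , 41) ∷ (63809 , 42) ∷ (67481 , 43) ∷ (71153 , 44) ∷ (75041 , 45) ∷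
  (78929 , 46) ∷ (83537 , 48) ∷ (88289 , 49) ∷ (93329 , 51) ∷ (98729 , 52) ∷ (104417 , 54) ∷ (110321 , 55) ∷
  (116657 , 57) ∷ (123209 , 58) ∷ (130337 , 60) ∷ (137537 , 61) ∷ (144737 , 63) ∷ (153089 , 65) ∷ (162017 , 67) ∷
  (171449 , 69) ∷ (181457 , 71) ∷ (191969 , 73) ∷ (203057 , 75) ∷ (214433 , 77) ∷ (226817 , 79) ∷ (239849 , 81) ∷
  (253601 , 84) ∷ (267929 , 86) ∷ (283553 , 88) ∷ (299969 , 91) ∷ (317321 , 94) ∷ (335681 , 96) ∷ (355193 , 99) ∷
  (375857 , 102) ∷ (397673 , 105) ∷ (420857 , 108) ∷ (444833 , 111) ∷ (470609 , 114) ∷ (497969 , 117) ∷ (526913 , 121) ∷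
  (557369 , 124) ∷ (589481 , 128) ∷ (623681 , 131) ∷ (659609 , 135) ∷ (697913 , 139) ∷ (737873 , 143) ∷ (779993 , 147) ∷
  (825353 , 151) ∷ (873017 , 155) ∷ (923849 , 160) ∷ (977057 , 164) ∷ (1034009 , 169) ∷ (1094129 , 174) ∷ (1157489 , 179) ∷
  (1224953 , 184) ∷ (1296089 , 189) ∷ (1371113 , 195) ∷ (1449953 , 200) ∷ (1534121 , 206) ∷ (1623473 , 212) ∷ (1718153 , 218) ∷
  (1818233 , 224) ∷ (1924289 , 231) ∷ (2036393 , 238) ∷ (2155121 , 244) ∷ (2280977 , 251) ∷ (2414177 , 259) ∷ (2555081 , 266) ∷
  (2704193 , 274) ∷ (2862017 , 282) ∷ (3028913 , 290) ∷ (3204953 , 298) ∷ (3391433 , 307) ∷ (3589361 , 315) ∷ (3798953 , 325) ∷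
  (4020713 , 334) ∷ (4255073 , 343) ∷ (4503041 , 353) ∷ (4765841 , 364) ∷ (5044049 , 374) ∷ (5338313 , 385) ∷ (5649569 , 396) ∷
  (5979401 , 407) ∷ (6328529 , 419) ∷ (6698033 , 431) ∷ (7088849 , 443) ∷ (7502633 , 456) ∷ (7940393 , 469) ∷ (8403641 , 483) ∷
  (8894321 , 497) ∷ (9413513 , 511) ∷ (9962801 , 526) ∷ (10544561 , 541) ∷ (11160161 , 556) ∷ (11810177 , 572) ∷ (12499577 , 589) ∷
  (13229441 , 606) ∷ (14001209 , 623) ∷ (14818697 , 641) ∷ (15683849 , 660) ∷ (16599617 , 679) ∷ (17568953 , 698) ∷ (18594881 , 718) ∷
  (19680641 , 739) ∷ (20828897 , 760) ∷ (22044977 , 782) ∷ (23332193 , 805) ∷ (24694361 , 828) ∷ (26136161 , 852) ∷ (27661913 , 876) ∷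
  (29277089 , 901) ∷ (30986369 , 927) ∷ (32795657 , 954) ∷ (34708913 , 982) ∷ (36735137 , 1010) ∷ (38880089 , 1039) ∷ (41150177 , 1069) ∷
  (43552601 , 1100) ∷ (46095641 , 1131) ∷ (48786713 , 1164) ∷ (51635537 , 1197) ∷ (54651041 , 1232) ∷ (57842297 , 1267) ∷ (61219817 , 1304) ∷
  (64794761 , 1341) ∷ (68578577 , 1380) ∷ (72583073 , 1420) ∷ (76821713 , 1460) ∷ (81308033 , 1503) ∷ (86056001 , 1546) ∷ (91081313 , 1590) ∷
  (96400097 , 1636) ∷ (102029129 , 1683) ∷ (107987273 , 1732) ∷ (114293681 , 1781) ∷ (120968369 , 1833) ∷ (128032649 , 1886) ∷ (135508913 , 1940) ∷
  (143422361 , 1996) ∷ (151798193 , 2053) ∷ (160662977 , 2112) ∷ (170045297 , 2173) ∷ (179975249 , 2236) ∷ (190485161 , 2300) ∷ (201609377 , 2366) ∷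
  (213383321 , 2434) ∷ (225844433 , 2504) ∷ (239032961 , 2576) ∷ (252991457 , 2651) ∷ (267766073 , 2727) ∷ (283403321 , 2805) ∷ (299954033 , 2886) ∷
  (317471129 , 2969) ∷ (336011057 , 3055) ∷ (355633073 , 3143) ∷ (376401401 , 3233) ∷ (398382713 , 3326) ∷ (421647929 , 3422) ∷ (446271857 , 3521) ∷
  (472333913 , 3622) ∷ (499916537 , 3726) ∷ (529111169 , 3833) ∷ (560011121 , 3944) ∷ (592715609 , 4057) ∷ (627329249 , 4174) ∷ (663965153 , 4294) ∷
  (702740609 , 4418) ∷ (743780537 , 4545) ∷ (787217273 , 4676) ∷ (833190209 , 4811) ∷ (881847809 , 4949) ∷ (933347537 , 5091) ∷ (987854849 , 5238) ∷
  (1045545209 , 5389) ∷ (1106604377 , 5544) ∷ (1171229057 , 5704) ∷ (1239627833 , 5868) ∷ (1312021457 , 6037) ∷ (1388643497 , 6210) ∷ (1469740121 , 6389) ∷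
  (1555572761 , 6573) ∷ (1646418113 , 6762) ∷ (1742568929 , 6957) ∷ (1844334881 , 7157) ∷ (1952043857 , 7363) ∷ (2066042177 , 7575) ∷ (2186698841 , 7793) ∷
  (2314401281 , 8018) ∷ (2449562273 , 8249) ∷ (2592616337 , 8486) ∷ (2744024849 , 8730) ∷ (2904274601 , 8982) ∷ (3073884137 , 9240) ∷ (3253398857 , 9506) ∷
  (3443396777 , 9780) ∷ (3644490977 , 10061) ∷ (3857329097 , 10351) ∷ (4082597009 , 10649) ∷ (4321020257 , 10955) ∷ (4573366289 , 11271) ∷ (4840450649 , 11595) ∷
  (5123132657 , 11929) ∷ (5422323041 , 12272) ∷ (5738986313 , 12626) ∷ (6074143001 , 12989) ∷ (6428872313 , 13363) ∷ (6804318041 , 13748) ∷ (7201689713 , 14143) ∷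
  (7622268281 , 14551) ∷ (8067408641 , 14969) ∷ (8538545177 , 15400) ∷ (9037196009 , 15844) ∷ (9564968249 , 16300) ∷ (10123562249 , 16769) ∷ []

chain19 : Vec Entry 236
chain19 =
  (19531 , 23) ∷ (20611 , 24) ∷ (21187 , 24) ∷ (22123 , 24) ∷ (23203 , 25) ∷ (24499 , 26) ∷ (25867 , 26) ∷
  (27091 , 27) ∷ (28603 , 28) ∷ (30259 , 29) ∷ (31771 , 29) ∷ (33427 , 30) ∷ (35227 , 31) ∷ (37243 , 32) ∷
  (39043 , 33) ∷ (41203 , 33) ∷ (43579 , 34) ∷ (46099 , 35) ∷ (48619 , 36) ∷ (51427 , 37) ∷ (54163 , 38) ∷
  (57259 , 40) ∷ (60427 , 41) ∷ (63667 , 42) ∷ (67339 , 43) ∷ (71011 , 44) ∷ (74827 , 45) ∷ (79147 , 47) ∷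
  (82963 , 48) ∷ (87643 , 49) ∷ (92683 , 50) ∷ (98011 , 52) ∷ (103699 , 53) ∷ (109387 , 55) ∷ (115363 , 56) ∷
  (121843 , 58) ∷ (128683 , 59) ∷ (136099 , 61) ∷ (143947 , 63) ∷ (152083 , 65) ∷ (160723 , 66) ∷ (169219 , 68) ∷
  (179083 , 70) ∷ (189523 , 72) ∷ (200467 , 74) ∷ (212131 , 76) ∷ (224443 , 79) ∷ (237547 , 81) ∷ (250867 , 83) ∷
  (265483 , 86) ∷ (280963 , 88) ∷ (297019 , 90) ∷ (314299 , 93) ∷ (332011 , 96) ∷ (350947 , 98) ∷ (371251 , 101) ∷
  (392923 , 104) ∷ (415819 , 107) ∷ (439867 , 110) ∷ (465211 , 113) ∷ (492067 , 117) ∷ (520363 , 120) ∷ (550531 , 123) ∷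
  (582643 , 127) ∷ (616411 , 131) ∷ (652339 , 134) ∷ (690427 , 138) ∷ (730747 , 142) ∷ (773371 , 146) ∷ (818371 , 150) ∷
  (865819 , 155) ∷ (916291 , 159) ∷ (969139 , 164) ∷ (1025659 , 168) ∷ (1085419 , 173) ∷ (1147987 , 178) ∷ (1214947 , 183) ∷
  (1285507 , 189) ∷ (1360531 , 194) ∷ (1439947 , 200) ∷ (1523539 , 205) ∷ (1611667 , 211) ∷ (1705339 , 217) ∷ (1804267 , 224) ∷
  (1909603 , 230) ∷ (2020771 , 237) ∷ (2138491 , 243) ∷ (2262979 , 250) ∷ (2394451 , 258) ∷ (2534131 , 265) ∷ (2681803 , 273) ∷
  (2837179 , 280) ∷ (3002491 , 288) ∷ (3177739 , 297) ∷ (3363211 , 305) ∷ (3559267 , 314) ∷ (3766699 , 323) ∷ (3985867 , 332) ∷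
  (4218283 , 342) ∷ (4464451 , 352) ∷ (4724947 , 362) ∷ (5000851 , 372) ∷ (5292883 , 383) ∷ (5601907 , 394) ∷ (5928787 , 405) ∷
  (6274747 , 417) ∷ (6641083 , 429) ∷ (7028299 , 442) ∷ (7438339 , 454) ∷ (7872643 , 467) ∷ (8331571 , 481) ∷ (8817931 , 495) ∷
  (9332803 , 509) ∷ (9877627 , 523) ∷ (10454419 , 539) ∷ (11064619 , 554) ∷ (11709883 , 570) ∷ (12393739 , 586) ∷ (13116331 , 603) ∷
  (13881331 , 621) ∷ (14691979 , 639) ∷ (15549931 , 657) ∷ (16457131 , 676) ∷ (17416459 , 695) ∷ (18432307 , 715) ∷ (19508563 , 736) ∷
  (20647747 , 757) ∷ (21853387 , 779) ∷ (23128867 , 801) ∷ (24478939 , 824) ∷ (25908283 , 848) ∷ (27420931 , 872) ∷ (29022283 , 898) ∷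
  (30717163 , 923) ∷ (32510251 , 950) ∷ (34408603 , 977) ∷ (36417331 , 1005) ∷ (38543851 , 1034) ∷ (40794643 , 1064) ∷ (43176979 , 1095) ∷
  (45697843 , 1126) ∷ (48366523 , 1159) ∷ (51190507 , 1192) ∷ (54179443 , 1226) ∷ (57342763 , 1262) ∷ (60691483 , 1298) ∷ (64235683 , 1335) ∷
  (67987027 , 1374) ∷ (71956603 , 1413) ∷ (76158811 , 1454) ∷ (80606179 , 1496) ∷ (85313539 , 1539) ∷ (90295291 , 1583) ∷ (95568283 , 1629) ∷
  (101149003 , 1676) ∷ (107055667 , 1724) ∷ (113307643 , 1774) ∷ (119924803 , 1825) ∷ (126927379 , 1877) ∷ (134339923 , 1931) ∷ (142185259 , 1987) ∷
  (150488803 , 2044) ∷ (159277123 , 2103) ∷ (168578731 , 2164) ∷ (178422067 , 2226) ∷ (188841547 , 2290) ∷ (199869499 , 2356) ∷ (211541779 , 2424) ∷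
  (223895611 , 2494) ∷ (236969659 , 2565) ∷ (250808419 , 2639) ∷ (265455163 , 2715) ∷ (280957483 , 2793) ∷ (297365347 , 2874) ∷ (314731243 , 2956) ∷
  (333111547 , 3042) ∷ (352565011 , 3129) ∷ (373154779 , 3219) ∷ (394946803 , 3312) ∷ (418011211 , 3407) ∷ (442423027 , 3505) ∷ (468260371 , 3606) ∷
  (495606547 , 3710) ∷ (524549323 , 3817) ∷ (555182731 , 3927) ∷ (587604547 , 4040) ∷ (621920539 , 4156) ∷ (658240147 , 4276) ∷ (696681163 , 4399) ∷
  (737366563 , 4525) ∷ (780428179 , 4656) ∷ (826004251 , 4790) ∷ (874242883 , 4928) ∷ (925298659 , 5069) ∷ (979335811 , 5215) ∷ (1036528939 , 5366) ∷
  (1097061499 , 5520) ∷ (1161129547 , 5679) ∷ (1228939507 , 5842) ∷ (1300709539 , 6011) ∷ (1376670331 , 6184) ∷ (1457067259 , 6362) ∷ (1542159739 , 6545) ∷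
  (1632220939 , 6733) ∷ (1727542603 , 6927) ∷ (1828430803 , 7126) ∷ (1935210331 , 7332) ∷ (2048226067 , 7543) ∷ (2167841827 , 7760) ∷ (2294443747 , 7983) ∷
  (2428439059 , 8213) ∷ (2570259691 , 8449) ∷ (2720362483 , 8693) ∷ (2879230051 , 8943) ∷ (3047376979 , 9200) ∷ (3225343267 , 9465) ∷ (3413702899 , 9737) ∷
  (3613062763 , 10018) ∷ (3824065603 , 10306) ∷ (4047391027 , 10603) ∷ (4283758099 , 10908) ∷ (4533929443 , 11222) ∷ (4798710883 , 11545) ∷ (5078955403 , 11877) ∷
  (5375566387 , 12219) ∷ (5689499419 , 12571) ∷ (6021766099 , 12933) ∷ (6373436851 , 13305) ∷ (6745645243 , 13688) ∷ (7139590867 , 14082) ∷ (7556542867 , 14488) ∷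
  (7997843611 , 14905) ∷ (8464917547 , 15334) ∷ (8959268251 , 15775) ∷ (9482489299 , 16229) ∷ (10036264627 , 16697) ∷ []

chain23 : Vec Entry 237
chain23 =
  (19463 , 23) ∷ (20543 , 24) ∷ (21407 , 24) ∷ (22343 , 25) ∷ (23567 , 25) ∷ (24359 , 26) ∷ (25583 , 26) ∷
  (26951 , 27) ∷ (28463 , 28) ∷ (30119 , 29) ∷ (31847 , 29) ∷ (33647 , 30) ∷ (35591 , 31) ∷ (37607 , 32) ∷
  (39623 , 33) ∷ (41927 , 34) ∷ (44159 , 35) ∷ (46679 , 36) ∷ (49199 , 37) ∷ (51719 , 38) ∷ (54311 , 39) ∷
  (57191 , 40) ∷ (59999 , 40) ∷ (63311 , 42) ∷ (66191 , 43) ∷ (69431 , 44) ∷ (72959 , 45) ∷ (76991 , 46) ∷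
  (81239 , 47) ∷ (85847 , 48) ∷ (90599 , 50) ∷ (95783 , 51) ∷ (101183 , 53) ∷ (106871 , 54) ∷ (113063 , 56) ∷
  (119183 , 57) ∷ (126023 , 59) ∷ (132863 , 60) ∷ (140423 , 62) ∷ (148199 , 64) ∷ (156623 , 66) ∷ (165551 , 67) ∷
  (174767 , 69) ∷ (184703 , 71) ∷ (195359 , 73) ∷ (206519 , 75) ∷ (218111 , 78) ∷ (230567 , 80) ∷ (243671 , 82) ∷
  (257783 , 84) ∷ (272759 , 87) ∷ (288527 , 89) ∷ (305231 , 92) ∷ (322871 , 94) ∷ (341447 , 97) ∷ (360959 , 100) ∷
  (381911 , 103) ∷ (403511 , 106) ∷ (426551 , 109) ∷ (451103 , 112) ∷ (477383 , 115) ∷ (505031 , 118) ∷ (534407 , 122) ∷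
  (565583 , 125) ∷ (598487 , 129) ∷ (633407 , 132) ∷ (670343 , 136) ∷ (709151 , 140) ∷ (750119 , 144) ∷ (793607 , 148) ∷
  (839903 , 152) ∷ (888431 , 157) ∷ (940271 , 161) ∷ (994991 , 166) ∷ (1052663 , 171) ∷ (1113863 , 176) ∷ (1178591 , 181) ∷
  (1247063 , 186) ∷ (1319711 , 191) ∷ (1396751 , 197) ∷ (1477823 , 202) ∷ (1564007 , 208) ∷ (1655231 , 214) ∷ (1751639 , 220) ∷
  (1853879 , 227) ∷ (1961447 , 233) ∷ (2075279 , 240) ∷ (2196239 , 247) ∷ (2324471 , 254) ∷ (2458679 , 261) ∷ (2601671 , 268) ∷
  (2752223 , 276) ∷ (2912783 , 284) ∷ (3082271 , 292) ∷ (3261911 , 301) ∷ (3452279 , 309) ∷ (3653303 , 318) ∷ (3865991 , 327) ∷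
  (4091279 , 337) ∷ (4330103 , 346) ∷ (4582967 , 356) ∷ (4850519 , 367) ∷ (5133407 , 377) ∷ (5432783 , 388) ∷ (5749943 , 399) ∷
  (6085103 , 411) ∷ (6440351 , 423) ∷ (6816263 , 435) ∷ (7214279 , 447) ∷ (7635263 , 460) ∷ (8080799 , 473) ∷ (8552471 , 487) ∷
  (9051863 , 501) ∷ (9580127 , 516) ∷ (10139351 , 530) ∷ (10731407 , 546) ∷ (11357807 , 561) ∷ (12021071 , 578) ∷ (12722351 , 594) ∷
  (13464599 , 611) ∷ (14250767 , 629) ∷ (15082367 , 647) ∷ (15962927 , 666) ∷ (16894967 , 685) ∷ (17881151 , 704) ∷ (18925367 , 725) ∷
  (20030207 , 746) ∷ (21199847 , 767) ∷ (22437887 , 789) ∷ (23746199 , 812) ∷ (25132703 , 835) ∷ (26600207 , 859) ∷ (28152959 , 884) ∷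
  (29796719 , 909) ∷ (31536383 , 936) ∷ (33377711 , 963) ∷ (35326463 , 990) ∷ (37389479 , 1019) ∷ (39572807 , 1048) ∷ (41883431 , 1078) ∷
  (44329343 , 1109) ∷ (46917599 , 1141) ∷ (49656911 , 1174) ∷ (52556783 , 1208) ∷ (55625783 , 1243) ∷ (58874063 , 1278) ∷ (62312279 , 1315) ∷
  (65951159 , 1353) ∷ (69802223 , 1392) ∷ (73878143 , 1432) ∷ (78192167 , 1473) ∷ (82758479 , 1516) ∷ (87591551 , 1560) ∷ (92706791 , 1604) ∷
  (98120471 , 1651) ∷ (103849943 , 1698) ∷ (109914719 , 1747) ∷ (116332871 , 1797) ∷ (123125423 , 1849) ∷ (130315487 , 1902) ∷ (137925527 , 1957) ∷
  (145980311 , 2013) ∷ (154503887 , 2071) ∷ (163526639 , 2131) ∷ (173076287 , 2192) ∷ (183183647 , 2255) ∷ (193881407 , 2320) ∷ (205203983 , 2387) ∷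
  (217187807 , 2456) ∷ (229871183 , 2527) ∷ (243295583 , 2599) ∷ (257503991 , 2674) ∷ (272542199 , 2751) ∷ (288458591 , 2830) ∷ (305304359 , 2912) ∷
  (323133791 , 2996) ∷ (342004631 , 3082) ∷ (361977071 , 3171) ∷ (383116343 , 3262) ∷ (405489911 , 3356) ∷ (429169271 , 3452) ∷ (454231607 , 3552) ∷
  (480758711 , 3654) ∷ (508833959 , 3759) ∷ (538549799 , 3867) ∷ (570000479 , 3979) ∷ (603288383 , 4093) ∷ (638519639 , 4211) ∷ (675808079 , 4332) ∷
  (715275167 , 4457) ∷ (757046399 , 4585) ∷ (801256487 , 4717) ∷ (848049143 , 4853) ∷ (897574487 , 4993) ∷ (949992287 , 5137) ∷ (1005471023 , 5285) ∷
  (1064189831 , 5437) ∷ (1126338071 , 5593) ∷ (1192114823 , 5754) ∷ (1261734143 , 5920) ∷ (1335418151 , 6090) ∷ (1413405311 , 6266) ∷ (1495947911 , 6446) ∷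
  (1583311199 , 6631) ∷ (1675776551 , 6822) ∷ (1773640751 , 7019) ∷ (1877220887 , 7221) ∷ (1986850319 , 7429) ∷ (2102882351 , 7643) ∷ (2225689799 , 7863) ∷
  (2355669671 , 8089) ∷ (2493240719 , 8322) ∷ (2638845743 , 8561) ∷ (2792953391 , 8808) ∷ (2956061687 , 9061) ∷ (3128695151 , 9322) ∷ (3311409263 , 9590) ∷
  (3504792407 , 9867) ∷ (3709471991 , 10151) ∷ (3926105087 , 10443) ∷ (4155389591 , 10743) ∷ (4398062927 , 11053) ∷ (4654908959 , 11371) ∷ (4926755399 , 11698) ∷
  (5214477767 , 12035) ∷ (5519002919 , 12381) ∷ (5841312431 , 12738) ∷ (6182443103 , 13104) ∷ (6543496247 , 13482) ∷ (6925636391 , 13870) ∷ (7330093223 , 14269) ∷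
  (7758170663 , 14680) ∷ (8211247223 , 15102) ∷ (8690783999 , 15537) ∷ (9198325247 , 15984) ∷ (9735507167 , 16444) ∷ (10304059631 , 16918) ∷ []

chain25 : Vec Entry 237
chain25 =
  (19249 , 23) ∷ (20113 , 23) ∷ (21193 , 24) ∷ (22273 , 25) ∷ (23497 , 25) ∷ (24793 , 26) ∷ (26161 , 27) ∷
  (27673 , 27) ∷ (28753 , 28) ∷ (29833 , 28) ∷ (31489 , 29) ∷ (33289 , 30) ∷ (35089 , 31) ∷ (36529 , 32) ∷
  (38329 , 32) ∷ (40129 , 33) ∷ (42433 , 34) ∷ (44809 , 35) ∷ (47041 , 36) ∷ (49633 , 37) ∷ (52369 , 38) ∷
  (55249 , 39) ∷ (58417 , 40) ∷ (61729 , 41) ∷ (65257 , 42) ∷ (69001 , 43) ∷ (72889 , 45) ∷ (77137 , 46) ∷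
  (81457 , 47) ∷ (86209 , 49) ∷ (91033 , 50) ∷ (96289 , 51) ∷ (101833 , 53) ∷ (107449 , 54) ∷ (113497 , 56) ∷
  (120121 , 57) ∷ (127033 , 59) ∷ (134161 , 61) ∷ (141937 , 62) ∷ (150217 , 64) ∷ (158209 , 66) ∷ (166849 , 68) ∷
  (176497 , 70) ∷ (186793 , 72) ∷ (197521 , 74) ∷ (208609 , 76) ∷ (220057 , 78) ∷ (232801 , 80) ∷ (246193 , 82) ∷
  (260089 , 85) ∷ (274993 , 87) ∷ (290761 , 90) ∷ (307609 , 92) ∷ (325537 , 95) ∷ (344257 , 97) ∷ (364129 , 100) ∷
  (385153 , 103) ∷ (407401 , 106) ∷ (431017 , 109) ∷ (455353 , 112) ∷ (481849 , 115) ∷ (509569 , 119) ∷ (539233 , 122) ∷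
  (570697 , 126) ∷ (603817 , 129) ∷ (638233 , 133) ∷ (675457 , 137) ∷ (714841 , 141) ∷ (756097 , 145) ∷ (800161 , 149) ∷
  (846673 , 153) ∷ (895777 , 157) ∷ (948049 , 162) ∷ (1003273 , 167) ∷ (1061737 , 171) ∷ (1123729 , 176) ∷ (1189033 , 181) ∷
  (1258441 , 187) ∷ (1331521 , 192) ∷ (1409209 , 198) ∷ (1491001 , 203) ∷ (1577689 , 209) ∷ (1669489 , 215) ∷ (1766761 , 221) ∷
  (1869793 , 228) ∷ (1978441 , 234) ∷ (2093929 , 241) ∷ (2216113 , 248) ∷ (2345209 , 255) ∷ (2482009 , 262) ∷ (2626873 , 270) ∷
  (2780233 , 278) ∷ (2942521 , 286) ∷ (3114313 , 294) ∷ (3295753 , 302) ∷ (3488209 , 311) ∷ (3690961 , 320) ∷ (3906169 , 329) ∷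
  (4134049 , 339) ∷ (4375321 , 348) ∷ (4630201 , 358) ∷ (4900057 , 369) ∷ (5185753 , 379) ∷ (5488081 , 390) ∷ (5808553 , 401) ∷
  (6146593 , 413) ∷ (6505153 , 425) ∷ (6884737 , 437) ∷ (7286497 , 450) ∷ (7711441 , 462) ∷ (8161081 , 476) ∷ (8637289 , 489) ∷
  (9141577 , 504) ∷ (9674953 , 518) ∷ (10239433 , 533) ∷ (10837249 , 548) ∷ (11470057 , 564) ∷ (12139873 , 580) ∷ (12848497 , 597) ∷
  (13598161 , 614) ∷ (14391889 , 632) ∷ (15231913 , 650) ∷ (16121257 , 669) ∷ (17061937 , 688) ∷ (18058129 , 708) ∷ (19112713 , 728) ∷
  (20228713 , 749) ∷ (21409009 , 771) ∷ (22658353 , 793) ∷ (23981497 , 816) ∷ (25381897 , 839) ∷ (26864017 , 864) ∷ (28432753 , 888) ∷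
  (30092929 , 914) ∷ (31850017 , 940) ∷ (33709633 , 967) ∷ (35677897 , 995) ∷ (37761433 , 1024) ∷ (39966361 , 1053) ∷ (42300169 , 1084) ∷
  (44769553 , 1115) ∷ (47383801 , 1147) ∷ (50150977 , 1180) ∷ (53079721 , 1214) ∷ (56179537 , 1249) ∷ (59460361 , 1285) ∷ (62932777 , 1322) ∷
  (66606721 , 1360) ∷ (70496521 , 1399) ∷ (74612833 , 1439) ∷ (78969481 , 1481) ∷ (83581081 , 1523) ∷ (88460881 , 1567) ∷ (93626881 , 1612) ∷
  (99093409 , 1659) ∷ (104879329 , 1707) ∷ (111004009 , 1756) ∷ (117486529 , 1806) ∷ (124347697 , 1858) ∷ (131609329 , 1912) ∷ (139295257 , 1967) ∷
  (147430033 , 2023) ∷ (156039721 , 2082) ∷ (165152329 , 2142) ∷ (174796513 , 2203) ∷ (185003017 , 2267) ∷ (195807121 , 2332) ∷ (207242017 , 2399) ∷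
  (219343777 , 2468) ∷ (232153081 , 2539) ∷ (245709601 , 2612) ∷ (260058481 , 2687) ∷ (275245081 , 2765) ∷ (291318217 , 2844) ∷ (308330593 , 2926) ∷
  (326337073 , 3010) ∷ (345394393 , 3097) ∷ (365564977 , 3186) ∷ (386913841 , 3278) ∷ (409509241 , 3372) ∷ (433424473 , 3469) ∷ (458736433 , 3569) ∷
  (485526193 , 3672) ∷ (513880153 , 3778) ∷ (543890689 , 3887) ∷ (575653417 , 3998) ∷ (609271441 , 4114) ∷ (644852473 , 4232) ∷ (682511353 , 4354) ∷
  (722369761 , 4479) ∷ (764556073 , 4608) ∷ (809206009 , 4741) ∷ (856461913 , 4877) ∷ (906479089 , 5018) ∷ (959417449 , 5162) ∷ (1015447273 , 5311) ∷
  (1074748561 , 5464) ∷ (1137512329 , 5621) ∷ (1203942769 , 5783) ∷ (1274252929 , 5949) ∷ (1348668889 , 6120) ∷ (1427430769 , 6297) ∷ (1510792369 , 6478) ∷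
  (1599022609 , 6664) ∷ (1692405457 , 6856) ∷ (1791241801 , 7054) ∷ (1895849521 , 7257) ∷ (2006567089 , 7465) ∷ (2123750401 , 7680) ∷ (2247776953 , 7901) ∷
  (2379046993 , 8129) ∷ (2517982009 , 8363) ∷ (2665031569 , 8604) ∷ (2820669217 , 8851) ∷ (2985396289 , 9106) ∷ (3159742561 , 9368) ∷ (3344270929 , 9638) ∷
  (3539576113 , 9915) ∷ (3746287249 , 10201) ∷ (3965070337 , 10494) ∷ (4196630401 , 10797) ∷ (4441712641 , 11107) ∷ (4701106681 , 11427) ∷ (4975650313 , 11756) ∷
  (5266228273 , 12094) ∷ (5573775769 , 12443) ∷ (5899284169 , 12801) ∷ (6243802153 , 13169) ∷ (6608439241 , 13548) ∷ (6994371481 , 13938) ∷ (7402842313 , 14340) ∷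
  (7835167969 , 14752) ∷ (8292741433 , 15177) ∷ (8777037481 , 15614) ∷ (9289616353 , 16063) ∷ (9832129873 , 16526) ∷ (10406326129 , 17002) ∷ []

chain29 : Vec Entry 237
chain29 =
  (19469 , 23) ∷ (20549 , 24) ∷ (21701 , 24) ∷ (22853 , 25) ∷ (24077 , 26) ∷ (25373 , 26) ∷ (26813 , 27) ∷
  (28181 , 28) ∷ (29333 , 28) ∷ (30773 , 29) ∷ (32429 , 30) ∷ (34301 , 31) ∷ (35597 , 31) ∷ (37397 , 32) ∷
  (39341 , 33) ∷ (41357 , 34) ∷ (43661 , 34) ∷ (46181 , 35) ∷ (48413 , 36) ∷ (50789 , 37) ∷ (53597 , 38) ∷
  (56477 , 39) ∷ (59357 , 40) ∷ (62597 , 41) ∷ (65981 , 42) ∷ (69653 , 44) ∷ (73613 , 45) ∷ (77573 , 46) ∷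
  (82037 , 47) ∷ (86573 , 49) ∷ (91541 , 50) ∷ (96797 , 52) ∷ (102197 , 53) ∷ (107741 , 54) ∷ (113933 , 56) ∷
  (120557 , 58) ∷ (127541 , 59) ∷ (134741 , 61) ∷ (142589 , 63) ∷ (150869 , 64) ∷ (159437 , 66) ∷ (168293 , 68) ∷
  (177797 , 70) ∷ (188021 , 72) ∷ (198533 , 74) ∷ (210053 , 76) ∷ (222293 , 78) ∷ (235181 , 80) ∷ (248861 , 83) ∷
  (262901 , 85) ∷ (278237 , 88) ∷ (294293 , 90) ∷ (310997 , 93) ∷ (328781 , 95) ∷ (347933 , 98) ∷ (368021 , 101) ∷
  (389189 , 104) ∷ (410789 , 106) ∷ (434261 , 109) ∷ (459317 , 113) ∷ (485021 , 116) ∷ (513173 , 119) ∷ (542981 , 122) ∷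
  (574373 , 126) ∷ (607493 , 130) ∷ (642701 , 133) ∷ (680213 , 137) ∷ (719813 , 141) ∷ (761429 , 145) ∷ (805853 , 149) ∷
  (852581 , 154) ∷ (902333 , 158) ∷ (954677 , 163) ∷ (1009901 , 167) ∷ (1068437 , 172) ∷ (1130501 , 177) ∷ (1196309 , 182) ∷
  (1266149 , 187) ∷ (1340021 , 193) ∷ (1418213 , 198) ∷ (1500797 , 204) ∷ (1588133 , 210) ∷ (1680509 , 216) ∷ (1778213 , 222) ∷
  (1882037 , 228) ∷ (1991837 , 235) ∷ (2107181 , 242) ∷ (2230157 , 249) ∷ (2360117 , 256) ∷ (2497637 , 263) ∷ (2642933 , 271) ∷
  (2797229 , 278) ∷ (2960453 , 286) ∷ (3133181 , 295) ∷ (3315989 , 303) ∷ (3509453 , 312) ∷ (3713789 , 321) ∷ (3930653 , 330) ∷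
  (4159973 , 340) ∷ (4402613 , 349) ∷ (4659293 , 359) ∷ (4931237 , 370) ∷ (5218589 , 380) ∷ (5523293 , 391) ∷ (5845781 , 403) ∷
  (6186413 , 414) ∷ (6547637 , 426) ∷ (6929453 , 438) ∷ (7332581 , 451) ∷ (7760693 , 464) ∷ (8213789 , 477) ∷ (8693381 , 491) ∷
  (9201053 , 505) ∷ (9738389 , 520) ∷ (10306613 , 535) ∷ (10907093 , 550) ∷ (11543933 , 566) ∷ (12217637 , 582) ∷ (12930941 , 599) ∷
  (13686077 , 616) ∷ (14485061 , 634) ∷ (15330629 , 652) ∷ (16225589 , 671) ∷ (17172893 , 690) ∷ (18175709 , 710) ∷ (19236629 , 731) ∷
  (20359541 , 752) ∷ (21547973 , 773) ∷ (22806101 , 796) ∷ (24137237 , 818) ∷ (25546421 , 842) ∷ (27038117 , 866) ∷ (28616789 , 891) ∷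
  (30287261 , 917) ∷ (32055797 , 943) ∷ (33927653 , 970) ∷ (35908877 , 998) ∷ (38005733 , 1027) ∷ (40224917 , 1057) ∷ (42573701 , 1087) ∷
  (45059789 , 1118) ∷ (47691101 , 1151) ∷ (50476133 , 1184) ∷ (53423813 , 1218) ∷ (56543429 , 1253) ∷ (59845493 , 1289) ∷ (63340373 , 1326) ∷
  (67038941 , 1364) ∷ (70953653 , 1404) ∷ (75097181 , 1444) ∷ (79482341 , 1486) ∷ (84124037 , 1528) ∷ (89036813 , 1572) ∷ (94236509 , 1618) ∷
  (99739253 , 1664) ∷ (105563837 , 1712) ∷ (111728621 , 1761) ∷ (118253477 , 1812) ∷ (125159357 , 1864) ∷ (132468653 , 1918) ∷ (140204621 , 1973) ∷
  (148392317 , 2030) ∷ (157058381 , 2088) ∷ (166230461 , 2149) ∷ (175937789 , 2210) ∷ (186212189 , 2274) ∷ (197086781 , 2339) ∷ (208595837 , 2407) ∷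
  (220777301 , 2476) ∷ (233670629 , 2547) ∷ (247316213 , 2621) ∷ (261758909 , 2696) ∷ (277045157 , 2774) ∷ (293223341 , 2854) ∷ (310346957 , 2936) ∷
  (328470221 , 3020) ∷ (347651957 , 3107) ∷ (367954373 , 3197) ∷ (389441693 , 3289) ∷ (412184837 , 3383) ∷ (436256237 , 3481) ∷ (461733581 , 3581) ∷
  (488698589 , 3684) ∷ (517238453 , 3790) ∷ (547444253 , 3899) ∷ (579414053 , 4012) ∷ (613251533 , 4127) ∷ (649064477 , 4246) ∷ (686969597 , 4368) ∷
  (727088357 , 4494) ∷ (769549997 , 4623) ∷ (814491389 , 4756) ∷ (862057613 , 4893) ∷ (912401309 , 5034) ∷ (965685197 , 5179) ∷ (1022080853 , 5328) ∷
  (1081770077 , 5481) ∷ (1144944677 , 5639) ∷ (1211809421 , 5802) ∷ (1282578653 , 5969) ∷ (1357480829 , 6140) ∷ (1436756861 , 6317) ∷ (1520663357 , 6499) ∷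
  (1609469669 , 6686) ∷ (1703462213 , 6879) ∷ (1802943677 , 7077) ∷ (1908235541 , 7280) ∷ (2019675341 , 7490) ∷ (2137624373 , 7705) ∷ (2262461573 , 7927) ∷
  (2394588701 , 8155) ∷ (2534432429 , 8390) ∷ (2682442757 , 8632) ∷ (2839096613 , 8880) ∷ (3004899437 , 9136) ∷ (3180384677 , 9399) ∷ (3366118397 , 9669) ∷
  (3562699277 , 9948) ∷ (3770760341 , 10234) ∷ (3990972413 , 10529) ∷ (4224044117 , 10832) ∷ (4470728069 , 11144) ∷ (4731818141 , 11464) ∷ (5008155653 , 11794) ∷
  (5300631029 , 12134) ∷ (5610187613 , 12483) ∷ (5937822461 , 12843) ∷ (6284590517 , 13212) ∷ (6651610157 , 13593) ∷ (7040063981 , 13984) ∷ (7451203709 , 14386) ∷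
  (7886353637 , 14801) ∷ (8346915893 , 15227) ∷ (8834374397 , 15665) ∷ (9350301773 , 16116) ∷ (9896358413 , 16580) ∷ (10474305581 , 17057) ∷ []

chain31 : Vec Entry 238
chain31 =
  (19471 , 23) ∷ (20551 , 24) ∷ (21559 , 24) ∷ (22783 , 25) ∷ (24007 , 25) ∷ (25303 , 26) ∷ (25951 , 27) ∷
  (27103 , 27) ∷ (28183 , 28) ∷ (29191 , 28) ∷ (30703 , 29) ∷ (32359 , 30) ∷ (34231 , 31) ∷ (35671 , 31) ∷
  (37039 , 32) ∷ (39199 , 33) ∷ (41143 , 33) ∷ (43159 , 34) ∷ (45319 , 35) ∷ (47911 , 36) ∷ (50647 , 37) ∷
  (53527 , 38) ∷ (56479 , 39) ∷ (59359 , 40) ∷ (62743 , 41) ∷ (66343 , 43) ∷ (69439 , 44) ∷ (73471 , 45) ∷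
  (77719 , 46) ∷ (82183 , 47) ∷ (86719 , 49) ∷ (91183 , 50) ∷ (96223 , 51) ∷ (101839 , 53) ∷ (107671 , 54) ∷
  (113719 , 56) ∷ (120199 , 57) ∷ (126967 , 59) ∷ (133519 , 61) ∷ (141223 , 62) ∷ (149287 , 64) ∷ (157999 , 66) ∷
  (167071 , 68) ∷ (176791 , 70) ∷ (186871 , 72) ∷ (197599 , 74) ∷ (208759 , 76) ∷ (220783 , 78) ∷ (233599 , 80) ∷
  (246919 , 82) ∷ (261031 , 85) ∷ (276151 , 87) ∷ (291559 , 90) ∷ (308551 , 92) ∷ (326479 , 95) ∷ (345487 , 98) ∷
  (364423 , 100) ∷ (385663 , 103) ∷ (408127 , 106) ∷ (431887 , 109) ∷ (457087 , 112) ∷ (483727 , 116) ∷ (511591 , 119) ∷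
  (540823 , 122) ∷ (571783 , 126) ∷ (604759 , 129) ∷ (640039 , 133) ∷ (677119 , 137) ∷ (716143 , 141) ∷ (757903 , 145) ∷
  (801607 , 149) ∷ (848119 , 153) ∷ (897223 , 158) ∷ (949567 , 162) ∷ (1005007 , 167) ∷ (1063471 , 172) ∷ (1125391 , 176) ∷
  (1190983 , 182) ∷ (1260319 , 187) ∷ (1333831 , 192) ∷ (1411519 , 198) ∷ (1493743 , 203) ∷ (1580647 , 209) ∷ (1672663 , 215) ∷
  (1770151 , 221) ∷ (1873471 , 228) ∷ (1982839 , 234) ∷ (2098471 , 241) ∷ (2220367 , 248) ∷ (2349679 , 255) ∷ (2486767 , 262) ∷
  (2631919 , 270) ∷ (2785423 , 278) ∷ (2947999 , 286) ∷ (3120079 , 294) ∷ (3301807 , 303) ∷ (3494191 , 311) ∷ (3697591 , 320) ∷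
  (3913159 , 329) ∷ (4141399 , 339) ∷ (4382887 , 349) ∷ (4638631 , 359) ∷ (4909279 , 369) ∷ (5193751 , 379) ∷ (5496943 , 390) ∷
  (5817703 , 402) ∷ (6157183 , 413) ∷ (6516463 , 425) ∷ (6896767 , 437) ∷ (7299463 , 450) ∷ (7725559 , 463) ∷ (8176639 , 476) ∷
  (8653279 , 490) ∷ (9157783 , 504) ∷ (9692383 , 519) ∷ (10257727 , 533) ∷ (10856407 , 549) ∷ (11490151 , 565) ∷ (12161119 , 581) ∷
  (12870967 , 598) ∷ (13622503 , 615) ∷ (14417671 , 633) ∷ (15259639 , 651) ∷ (16150423 , 669) ∷ (17093119 , 689) ∷ (18090607 , 709) ∷
  (19146991 , 729) ∷ (20265151 , 750) ∷ (21448327 , 772) ∷ (22700767 , 794) ∷ (24026143 , 817) ∷ (25428703 , 840) ∷ (26913631 , 864) ∷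
  (28485103 , 889) ∷ (30148519 , 915) ∷ (31908991 , 941) ∷ (33771919 , 968) ∷ (35743567 , 996) ∷ (37830271 , 1025) ∷ (40038799 , 1054) ∷
  (42376567 , 1085) ∷ (44850271 , 1116) ∷ (47469271 , 1148) ∷ (50241343 , 1181) ∷ (53174983 , 1215) ∷ (56280199 , 1250) ∷ (59565631 , 1286) ∷
  (63044167 , 1323) ∷ (66724663 , 1361) ∷ (70620871 , 1400) ∷ (74745103 , 1441) ∷ (79109743 , 1482) ∷ (83729263 , 1525) ∷ (88618711 , 1569) ∷
  (93793639 , 1614) ∷ (99270319 , 1660) ∷ (105067399 , 1708) ∷ (111202951 , 1757) ∷ (117696343 , 1808) ∷ (124569751 , 1860) ∷ (131844199 , 1913) ∷
  (139542727 , 1968) ∷ (147691759 , 2025) ∷ (156316423 , 2083) ∷ (165443503 , 2143) ∷ (175103959 , 2205) ∷ (185329399 , 2269) ∷ (196152223 , 2334) ∷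
  (207607423 , 2401) ∷ (219731431 , 2470) ∷ (232563703 , 2541) ∷ (246145279 , 2615) ∷ (260519359 , 2690) ∷ (275733607 , 2767) ∷ (291836047 , 2847) ∷
  (308878951 , 2929) ∷ (326917471 , 3013) ∷ (346009423 , 3100) ∷ (366216007 , 3189) ∷ (387602959 , 3281) ∷ (410238967 , 3375) ∷ (434196823 , 3473) ∷
  (459553351 , 3573) ∷ (486390991 , 3675) ∷ (514795999 , 3781) ∷ (544858663 , 3890) ∷ (576677839 , 4002) ∷ (610352023 , 4117) ∷ (645995983 , 4236) ∷
  (683721967 , 4358) ∷ (723650647 , 4483) ∷ (765911623 , 4612) ∷ (810640759 , 4745) ∷ (857982127 , 4882) ∷ (908088007 , 5022) ∷ (961120327 , 5167) ∷
  (1017248719 , 5315) ∷ (1076655991 , 5468) ∷ (1139532439 , 5626) ∷ (1206080671 , 5788) ∷ (1276515679 , 5954) ∷ (1351064191 , 6126) ∷ (1429966183 , 6302) ∷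
  (1513475959 , 6484) ∷ (1601862799 , 6670) ∷ (1695411103 , 6862) ∷ (1794422983 , 7060) ∷ (1899217183 , 7263) ∷ (2010129439 , 7472) ∷ (2127520543 , 7687) ∷
  (2251767703 , 7908) ∷ (2383270807 , 8136) ∷ (2522453287 , 8370) ∷ (2669763991 , 8611) ∷ (2825676967 , 8859) ∷ (2990695999 , 9114) ∷ (3165351799 , 9377) ∷
  (3350208271 , 9646) ∷ (3545860063 , 9924) ∷ (3752937967 , 10210) ∷ (3972109423 , 10504) ∷ (4204078519 , 10806) ∷ (4449596287 , 11117) ∷ (4709452639 , 11437) ∷
  (4984483639 , 11766) ∷ (5275577191 , 12105) ∷ (5583670663 , 12454) ∷ (5909756647 , 12812) ∷ (6254884687 , 13181) ∷ (6620169847 , 13560) ∷ (7006787743 , 13951) ∷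
  (7415984119 , 14352) ∷ (7849077007 , 14766) ∷ (8307462847 , 15191) ∷ (8792618143 , 15628) ∷ (9306107023 , 16078) ∷ (9849583543 , 16541) ∷ (10424798887 , 17017) ∷ []

chain35 : Vec Entry 236
chain35 =
  (19403 , 23) ∷ (20483 , 24) ∷ (21563 , 24) ∷ (22787 , 25) ∷ (24083 , 26) ∷ (25307 , 26) ∷ (26459 , 27) ∷
  (27827 , 27) ∷ (29411 , 28) ∷ (30851 , 29) ∷ (32579 , 30) ∷ (34019 , 30) ∷ (35963 , 31) ∷ (37907 , 32) ∷
  (39779 , 33) ∷ (42083 , 34) ∷ (44531 , 35) ∷ (47123 , 36) ∷ (49787 , 37) ∷ (52667 , 38) ∷ (55691 , 39) ∷
  (58787 , 40) ∷ (62171 , 41) ∷ (65699 , 42) ∷ (69371 , 44) ∷ (73331 , 45) ∷ (77291 , 46) ∷ (81611 , 47) ∷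
  (86291 , 49) ∷ (90971 , 50) ∷ (95723 , 51) ∷ (101267 , 53) ∷ (107171 , 54) ∷ (113363 , 56) ∷ (119771 , 57) ∷
  (126683 , 59) ∷ (133811 , 61) ∷ (141587 , 62) ∷ (149579 , 64) ∷ (158003 , 66) ∷ (166931 , 68) ∷ (176651 , 70) ∷
  (186947 , 72) ∷ (197243 , 74) ∷ (207971 , 76) ∷ (219851 , 78) ∷ (232523 , 80) ∷ (245771 , 82) ∷ (259667 , 85) ∷
  (274787 , 87) ∷ (290627 , 90) ∷ (307259 , 92) ∷ (325187 , 95) ∷ (343547 , 97) ∷ (363563 , 100) ∷ (384299 , 103) ∷
  (406547 , 106) ∷ (430091 , 109) ∷ (455003 , 112) ∷ (481571 , 115) ∷ (509363 , 119) ∷ (538739 , 122) ∷ (570131 , 126) ∷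
  (602891 , 129) ∷ (637883 , 133) ∷ (674603 , 137) ∷ (713987 , 140) ∷ (755387 , 145) ∷ (799307 , 149) ∷ (845531 , 153) ∷
  (894779 , 157) ∷ (946331 , 162) ∷ (1001411 , 166) ∷ (1059299 , 171) ∷ (1121147 , 176) ∷ (1185659 , 181) ∷ (1254203 , 186) ∷
  (1327427 , 192) ∷ (1404899 , 197) ∷ (1486907 , 203) ∷ (1573667 , 209) ∷ (1665467 , 215) ∷ (1762451 , 221) ∷ (1865267 , 227) ∷
  (1973627 , 234) ∷ (2088683 , 241) ∷ (2210651 , 247) ∷ (2338883 , 255) ∷ (2474603 , 262) ∷ (2618747 , 269) ∷ (2771603 , 277) ∷
  (2933171 , 285) ∷ (3104459 , 293) ∷ (3285683 , 302) ∷ (3477203 , 310) ∷ (3679451 , 319) ∷ (3894227 , 329) ∷ (4121603 , 338) ∷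
  (4362299 , 348) ∷ (4616819 , 358) ∷ (4886027 , 368) ∷ (5170643 , 379) ∷ (5471387 , 390) ∷ (5790563 , 401) ∷ (6128531 , 412) ∷
  (6486083 , 424) ∷ (6864587 , 436) ∷ (7265339 , 449) ∷ (7689419 , 462) ∷ (8137979 , 475) ∷ (8613107 , 489) ∷ (9116099 , 503) ∷
  (9648323 , 517) ∷ (10211723 , 532) ∷ (10808027 , 548) ∷ (11439107 , 563) ∷ (12106979 , 580) ∷ (12814019 , 596) ∷ (13561883 , 613) ∷
  (14353739 , 631) ∷ (15191819 , 649) ∷ (16079003 , 668) ∷ (17017811 , 687) ∷ (18011627 , 707) ∷ (19062971 , 727) ∷ (20175803 , 748) ∷
  (21353939 , 770) ∷ (22600763 , 792) ∷ (23920163 , 815) ∷ (25316387 , 838) ∷ (26794763 , 862) ∷ (28359323 , 887) ∷ (30014819 , 913) ∷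
  (31767587 , 939) ∷ (33622451 , 966) ∷ (35585603 , 994) ∷ (37663523 , 1023) ∷ (39861827 , 1052) ∷ (42188507 , 1082) ∷ (44651987 , 1113) ∷
  (47259539 , 1145) ∷ (50019443 , 1178) ∷ (52940483 , 1212) ∷ (56032091 , 1247) ∷ (59303987 , 1283) ∷ (62767259 , 1320) ∷ (66432563 , 1358) ∷
  (70311347 , 1397) ∷ (74416931 , 1437) ∷ (78762491 , 1479) ∷ (83361923 , 1521) ∷ (88229699 , 1565) ∷ (93381947 , 1610) ∷ (98835299 , 1657) ∷
  (104606891 , 1704) ∷ (110715659 , 1753) ∷ (117180971 , 1804) ∷ (124024283 , 1856) ∷ (131267267 , 1909) ∷ (138933251 , 1964) ∷ (147046931 , 2021) ∷
  (155634443 , 2079) ∷ (164722787 , 2139) ∷ (174342491 , 2200) ∷ (184524083 , 2264) ∷ (195300251 , 2329) ∷ (206705699 , 2396) ∷ (218777003 , 2465) ∷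
  (231553547 , 2536) ∷ (245076011 , 2609) ∷ (259388387 , 2684) ∷ (274536611 , 2761) ∷ (290569427 , 2841) ∷ (307538603 , 2922) ∷ (325498499 , 3007) ∷
  (344507003 , 3093) ∷ (364626179 , 3182) ∷ (385920251 , 3274) ∷ (408457619 , 3368) ∷ (432310499 , 3465) ∷ (457556219 , 3565) ∷ (484277291 , 3667) ∷
  (512558603 , 3773) ∷ (542491163 , 3882) ∷ (574172531 , 3993) ∷ (607703939 , 4108) ∷ (643193027 , 4227) ∷ (680755499 , 4348) ∷ (720511523 , 4473) ∷
  (762588179 , 4602) ∷ (807123131 , 4735) ∷ (854259083 , 4871) ∷ (904147523 , 5011) ∷ (956949443 , 5155) ∷ (1012834763 , 5304) ∷ (1071984059 , 5457) ∷
  (1134587627 , 5614) ∷ (1200846419 , 5775) ∷ (1270975499 , 5941) ∷ (1345200371 , 6112) ∷ (1423759859 , 6288) ∷ (1506907187 , 6469) ∷ (1594909331 , 6656) ∷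
  (1688051987 , 6847) ∷ (1786634027 , 7044) ∷ (1890972971 , 7247) ∷ (2001405779 , 7456) ∷ (2118286043 , 7670) ∷ (2241993707 , 7891) ∷ (2372926067 , 8118) ∷
  (2511504899 , 8352) ∷ (2658176531 , 8593) ∷ (2813413931 , 8840) ∷ (2977717139 , 9094) ∷ (3151614131 , 9356) ∷ (3335668163 , 9626) ∷ (3530471003 , 9903) ∷
  (3736650347 , 10188) ∷ (3954870611 , 10481) ∷ (4185834659 , 10783) ∷ (4430285747 , 11093) ∷ (4689013787 , 11412) ∷ (4962852179 , 11741) ∷ (5252682419 , 12079) ∷
  (5559437843 , 12427) ∷ (5884108163 , 12784) ∷ (6227739971 , 13152) ∷ (6591439979 , 13531) ∷ (6976379843 , 13920) ∷ (7383800339 , 14321) ∷ (7815014243 , 14733) ∷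
  (8271411011 , 15158) ∷ (8754461171 , 15594) ∷ (9265721579 , 16043) ∷ (9806839451 , 16505) ∷ (10379557403 , 16980) ∷ []

chain37 : Vec Entry 236
chain37 =
  (19477 , 23) ∷ (20341 , 23) ∷ (21493 , 24) ∷ (22717 , 25) ∷ (23869 , 25) ∷ (25237 , 26) ∷ (26317 , 27) ∷
  (27541 , 27) ∷ (28909 , 28) ∷ (30493 , 29) ∷ (32077 , 30) ∷ (33589 , 30) ∷ (35533 , 31) ∷ (37549 , 32) ∷
  (39709 , 33) ∷ (42013 , 34) ∷ (44389 , 35) ∷ (46549 , 36) ∷ (49069 , 37) ∷ (51517 , 37) ∷ (54469 , 39) ∷
  (57637 , 40) ∷ (60733 , 41) ∷ (64189 , 42) ∷ (67933 , 43) ∷ (71821 , 44) ∷ (75997 , 46) ∷ (80317 , 47) ∷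
  (84421 , 48) ∷ (89317 , 49) ∷ (93997 , 51) ∷ (99469 , 52) ∷ (105229 , 54) ∷ (110989 , 55) ∷ (117109 , 57) ∷
  (123733 , 58) ∷ (130069 , 60) ∷ (137413 , 61) ∷ (144973 , 63) ∷ (152821 , 65) ∷ (161461 , 67) ∷ (170749 , 69) ∷
  (180541 , 70) ∷ (190909 , 72) ∷ (201997 , 75) ∷ (213589 , 77) ∷ (225829 , 79) ∷ (238789 , 81) ∷ (252541 , 83) ∷
  (267229 , 86) ∷ (282493 , 88) ∷ (298693 , 91) ∷ (315829 , 93) ∷ (334261 , 96) ∷ (353629 , 99) ∷ (374149 , 102) ∷
  (395749 , 105) ∷ (418357 , 107) ∷ (442333 , 111) ∷ (468109 , 114) ∷ (495181 , 117) ∷ (524053 , 120) ∷ (554293 , 124) ∷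
  (586189 , 127) ∷ (620317 , 131) ∷ (656389 , 135) ∷ (694549 , 139) ∷ (734941 , 143) ∷ (777781 , 147) ∷ (822853 , 151) ∷
  (870589 , 155) ∷ (921133 , 160) ∷ (974773 , 164) ∷ (1030933 , 169) ∷ (1091053 , 174) ∷ (1153261 , 179) ∷ (1220437 , 184) ∷
  (1291501 , 189) ∷ (1366597 , 195) ∷ (1446301 , 200) ∷ (1530541 , 206) ∷ (1619677 , 212) ∷ (1713997 , 218) ∷ (1813789 , 224) ∷
  (1919341 , 231) ∷ (2031301 , 237) ∷ (2149813 , 244) ∷ (2275309 , 251) ∷ (2408149 , 258) ∷ (2548621 , 266) ∷ (2697301 , 273) ∷
  (2854549 , 281) ∷ (3021157 , 289) ∷ (3196981 , 298) ∷ (3383173 , 306) ∷ (3580669 , 315) ∷ (3789757 , 324) ∷ (4010581 , 333) ∷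
  (4244437 , 343) ∷ (4491829 , 353) ∷ (4754053 , 363) ∷ (5031469 , 374) ∷ (5325157 , 384) ∷ (5635549 , 395) ∷ (5964661 , 407) ∷
  (6312853 , 418) ∷ (6681421 , 430) ∷ (7071013 , 443) ∷ (7483933 , 456) ∷ (7920613 , 469) ∷ (8383069 , 482) ∷ (8872309 , 496) ∷
  (9390061 , 510) ∷ (9938413 , 525) ∷ (10518661 , 540) ∷ (11132029 , 556) ∷ (11782117 , 572) ∷ (12469861 , 588) ∷ (13197637 , 605) ∷
  (13968181 , 623) ∷ (14783581 , 640) ∷ (15646933 , 659) ∷ (16560613 , 678) ∷ (17527717 , 697) ∷ (18551053 , 718) ∷ (19633573 , 738) ∷
  (20780173 , 759) ∷ (21992941 , 781) ∷ (23276917 , 804) ∷ (24635773 , 827) ∷ (26073613 , 851) ∷ (27596053 , 875) ∷ (29207557 , 900) ∷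
  (30912949 , 926) ∷ (32717053 , 953) ∷ (34627573 , 980) ∷ (36649621 , 1009) ∷ (38789893 , 1038) ∷ (41054869 , 1068) ∷ (43452397 , 1098) ∷
  (45989533 , 1130) ∷ (48674917 , 1162) ∷ (51517261 , 1196) ∷ (54523837 , 1230) ∷ (57707893 , 1266) ∷ (61077997 , 1302) ∷ (64644373 , 1340) ∷
  (68418613 , 1378) ∷ (72413461 , 1418) ∷ (76642309 , 1459) ∷ (81118189 , 1501) ∷ (85854781 , 1544) ∷ (90868069 , 1588) ∷ (96174037 , 1634) ∷
  (101790541 , 1681) ∷ (107735077 , 1730) ∷ (114026509 , 1779) ∷ (120684709 , 1831) ∷ (127732357 , 1883) ∷ (135191773 , 1938) ∷ (143086357 , 1993) ∷
  (151442461 , 2051) ∷ (160286653 , 2110) ∷ (169647229 , 2170) ∷ (179554213 , 2233) ∷ (190039933 , 2297) ∷ (201137221 , 2363) ∷ (212883157 , 2431) ∷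
  (225315397 , 2501) ∷ (238473397 , 2573) ∷ (252400069 , 2648) ∷ (267140197 , 2724) ∷ (282740581 , 2802) ∷ (299252557 , 2883) ∷ (316728757 , 2966) ∷
  (335225701 , 3051) ∷ (354801709 , 3139) ∷ (375521581 , 3229) ∷ (397451917 , 3322) ∷ (420662701 , 3418) ∷ (445228237 , 3516) ∷ (471229237 , 3618) ∷
  (498748933 , 3722) ∷ (527875741 , 3829) ∷ (558703333 , 3939) ∷ (591331501 , 4053) ∷ (625865221 , 4169) ∷ (662414869 , 4289) ∷ (701098597 , 4413) ∷
  (742041757 , 4540) ∷ (785376901 , 4670) ∷ (831242413 , 4805) ∷ (879786109 , 4943) ∷ (931165597 , 5086) ∷ (985545037 , 5232) ∷ (1043100829 , 5383) ∷
  (1104017869 , 5537) ∷ (1168492357 , 5697) ∷ (1236731653 , 5861) ∷ (1308954781 , 6030) ∷ (1385397109 , 6203) ∷ (1466303653 , 6382) ∷ (1551935701 , 6565) ∷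
  (1642566997 , 6754) ∷ (1738492669 , 6949) ∷ (1840020229 , 7149) ∷ (1947476413 , 7355) ∷ (2061208477 , 7566) ∷ (2181582901 , 7784) ∷ (2308986973 , 8008) ∷
  (2443831381 , 8239) ∷ (2586550717 , 8476) ∷ (2737604269 , 8720) ∷ (2897479693 , 8971) ∷ (3066691717 , 9229) ∷ (3245786389 , 9495) ∷ (3435340141 , 9768) ∷
  (3635962093 , 10049) ∷ (3848302261 , 10339) ∷ (4073042989 , 10636) ∷ (4310907949 , 10943) ∷ (4562664373 , 11258) ∷ (4829123917 , 11582) ∷ (5111144461 , 11915) ∷
  (5409634933 , 12258) ∷ (5725557181 , 12611) ∷ (6059929573 , 12974) ∷ (6413827141 , 13347) ∷ (6788393749 , 13732) ∷ (7184835829 , 14127) ∷ (7604430013 , 14534) ∷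
  (8048527381 , 14952) ∷ (8518561309 , 15382) ∷ (9016044517 , 15825) ∷ (9542581093 , 16281) ∷ (10099867357 , 16749) ∷ []

chain41 : Vec Entry 237
chain41 =
  (19121 , 23) ∷ (20201 , 23) ∷ (20921 , 24) ∷ (22073 , 24) ∷ (23297 , 25) ∷ (24593 , 26) ∷ (25889 , 26) ∷
  (27329 , 27) ∷ (28697 , 28) ∷ (30137 , 29) ∷ (31793 , 29) ∷ (33521 , 30) ∷ (35393 , 31) ∷ (37409 , 32) ∷
  (39569 , 33) ∷ (41801 , 34) ∷ (43961 , 35) ∷ (46337 , 36) ∷ (48857 , 37) ∷ (51593 , 38) ∷ (54401 , 39) ∷
  (56993 , 39) ∷ (60161 , 41) ∷ (63617 , 42) ∷ (67289 , 43) ∷ (70529 , 44) ∷ (74561 , 45) ∷ (78809 , 46) ∷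
  (83273 , 48) ∷ (87881 , 49) ∷ (92993 , 50) ∷ (98321 , 52) ∷ (104009 , 53) ∷ (109913 , 55) ∷ (116177 , 56) ∷
  (122081 , 58) ∷ (129209 , 60) ∷ (136481 , 61) ∷ (143609 , 63) ∷ (151817 , 65) ∷ (160313 , 66) ∷ (169457 , 68) ∷
  (179321 , 70) ∷ (189617 , 72) ∷ (200273 , 74) ∷ (211433 , 76) ∷ (223529 , 78) ∷ (236129 , 81) ∷ (249881 , 83) ∷
  (264353 , 85) ∷ (279761 , 88) ∷ (295961 , 90) ∷ (313241 , 93) ∷ (331241 , 96) ∷ (350249 , 98) ∷ (370193 , 101) ∷
  (391217 , 104) ∷ (413753 , 107) ∷ (437729 , 110) ∷ (462713 , 113) ∷ (488993 , 116) ∷ (517289 , 120) ∷ (547241 , 123) ∷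
  (578777 , 126) ∷ (612401 , 130) ∷ (648041 , 134) ∷ (685697 , 138) ∷ (725009 , 142) ∷ (766769 , 146) ∷ (811337 , 150) ∷
  (858713 , 154) ∷ (908321 , 159) ∷ (961313 , 163) ∷ (1017329 , 168) ∷ (1076657 , 173) ∷ (1139081 , 178) ∷ (1205537 , 183) ∷
  (1275737 , 188) ∷ (1349897 , 193) ∷ (1428593 , 199) ∷ (1511897 , 205) ∷ (1600097 , 210) ∷ (1692473 , 216) ∷ (1791113 , 223) ∷
  (1895657 , 229) ∷ (2006033 , 236) ∷ (2122961 , 243) ∷ (2246297 , 249) ∷ (2377121 , 257) ∷ (2515577 , 264) ∷ (2662097 , 272) ∷
  (2816969 , 279) ∷ (2981417 , 287) ∷ (3155513 , 296) ∷ (3339617 , 304) ∷ (3534449 , 313) ∷ (3740081 , 322) ∷ (3958457 , 331) ∷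
  (4189217 , 341) ∷ (4433729 , 351) ∷ (4692641 , 361) ∷ (4966673 , 371) ∷ (5256401 , 382) ∷ (5563121 , 393) ∷ (5887769 , 404) ∷
  (6231569 , 416) ∷ (6595313 , 428) ∷ (6979937 , 440) ∷ (7387169 , 453) ∷ (7818233 , 466) ∷ (8274713 , 479) ∷ (8757473 , 493) ∷
  (9268817 , 507) ∷ (9810113 , 522) ∷ (10383017 , 537) ∷ (10989257 , 552) ∷ (11630849 , 568) ∷ (12309953 , 584) ∷ (13028369 , 601) ∷
  (13788329 , 619) ∷ (14593217 , 636) ∷ (15445049 , 655) ∷ (16346921 , 674) ∷ (17301569 , 693) ∷ (18311081 , 713) ∷ (19379993 , 733) ∷
  (20511041 , 754) ∷ (21708761 , 776) ∷ (22975817 , 799) ∷ (24317537 , 822) ∷ (25737449 , 845) ∷ (27240377 , 870) ∷ (28831073 , 895) ∷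
  (30514793 , 920) ∷ (32296721 , 947) ∷ (34182041 , 974) ∷ (36178169 , 1002) ∷ (38290793 , 1031) ∷ (40526033 , 1061) ∷ (42892673 , 1091) ∷
  (45397337 , 1123) ∷ (48047801 , 1155) ∷ (50853641 , 1188) ∷ (53823353 , 1222) ∷ (56966513 , 1258) ∷ (60293201 , 1294) ∷ (63814001 , 1331) ∷
  (67540721 , 1369) ∷ (71485097 , 1409) ∷ (75659657 , 1449) ∷ (80078081 , 1491) ∷ (84753833 , 1534) ∷ (89703113 , 1578) ∷ (94941761 , 1624) ∷
  (100486049 , 1670) ∷ (106354337 , 1718) ∷ (112565417 , 1768) ∷ (119139233 , 1819) ∷ (126096953 , 1871) ∷ (133460321 , 1925) ∷ (141254177 , 1981) ∷
  (149503073 , 2038) ∷ (158234009 , 2096) ∷ (167474129 , 2157) ∷ (177254321 , 2219) ∷ (187605617 , 2282) ∷ (198561353 , 2348) ∷ (210157313 , 2416) ∷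
  (222430073 , 2485) ∷ (235419953 , 2557) ∷ (249168281 , 2631) ∷ (263719481 , 2706) ∷ (279119849 , 2784) ∷ (295419713 , 2864) ∷ (312672209 , 2947) ∷
  (330932201 , 3032) ∷ (350256713 , 3119) ∷ (370710257 , 3209) ∷ (392359577 , 3301) ∷ (415272929 , 3396) ∷ (439523897 , 3494) ∷ (465191681 , 3594) ∷
  (492358649 , 3698) ∷ (521112353 , 3804) ∷ (551544809 , 3914) ∷ (583753433 , 4026) ∷ (617844137 , 4142) ∷ (653926073 , 4262) ∷ (692115233 , 4384) ∷
  (732533873 , 4511) ∷ (775312961 , 4640) ∷ (820591169 , 4774) ∷ (868513433 , 4911) ∷ (919234049 , 5053) ∷ (972916673 , 5198) ∷ (1029734033 , 5348) ∷
  (1089870233 , 5502) ∷ (1153518449 , 5660) ∷ (1220883737 , 5823) ∷ (1292182673 , 5991) ∷ (1367645009 , 6163) ∷ (1447515257 , 6341) ∷ (1532050097 , 6523) ∷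
  (1621521401 , 6711) ∷ (1716217889 , 6904) ∷ (1816444913 , 7103) ∷ (1922525249 , 7307) ∷ (2034800249 , 7518) ∷ (2153632433 , 7734) ∷ (2279403977 , 7957) ∷
  (2412520889 , 8186) ∷ (2553411929 , 8422) ∷ (2702529761 , 8664) ∷ (2860357433 , 8913) ∷ (3027401249 , 9170) ∷ (3204200561 , 9434) ∷ (3391324889 , 9706) ∷
  (3589377089 , 9985) ∷ (3798996449 , 10272) ∷ (4020857681 , 10568) ∷ (4255675601 , 10872) ∷ (4504206353 , 11185) ∷ (4767251729 , 11507) ∷ (5045658953 , 11838) ∷
  (5340325217 , 12179) ∷ (5652199841 , 12530) ∷ (5982288233 , 12891) ∷ (6331653113 , 13262) ∷ (6701420633 , 13643) ∷ (7092783329 , 14036) ∷ (7507001849 , 14440) ∷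
  (7945410569 , 14856) ∷ (8409422201 , 15283) ∷ (8900531753 , 15723) ∷ (9420322361 , 16176) ∷ (9970468817 , 16642) ∷ (10552743977 , 17121) ∷ []

chain43 : Vec Entry 238
chain43 =
  (19483 , 23) ∷ (20563 , 24) ∷ (21499 , 24) ∷ (22651 , 25) ∷ (23371 , 25) ∷ (24379 , 26) ∷ (25747 , 26) ∷
  (27043 , 27) ∷ (28411 , 28) ∷ (29851 , 28) ∷ (31219 , 29) ∷ (32803 , 30) ∷ (34603 , 31) ∷ (36187 , 31) ∷
  (37987 , 32) ∷ (39499 , 33) ∷ (41659 , 34) ∷ (43963 , 35) ∷ (46411 , 36) ∷ (49003 , 37) ∷ (51307 , 37) ∷
  (53899 , 38) ∷ (56923 , 39) ∷ (60091 , 41) ∷ (63331 , 42) ∷ (67003 , 43) ∷ (70891 , 44) ∷ (74923 , 45) ∷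
  (78307 , 46) ∷ (82699 , 48) ∷ (87523 , 49) ∷ (92419 , 50) ∷ (97459 , 52) ∷ (102931 , 53) ∷ (108907 , 55) ∷
  (115099 , 56) ∷ (121579 , 58) ∷ (128563 , 59) ∷ (135979 , 61) ∷ (143827 , 63) ∷ (151603 , 65) ∷ (160387 , 66) ∷
  (169531 , 68) ∷ (179107 , 70) ∷ (189547 , 72) ∷ (200131 , 74) ∷ (211723 , 76) ∷ (223963 , 79) ∷ (236779 , 81) ∷
  (250027 , 83) ∷ (264283 , 85) ∷ (279619 , 88) ∷ (295819 , 90) ∷ (312451 , 93) ∷ (330019 , 95) ∷ (349171 , 98) ∷
  (369331 , 101) ∷ (390499 , 104) ∷ (413251 , 107) ∷ (437083 , 110) ∷ (462571 , 113) ∷ (489571 , 116) ∷ (518083 , 120) ∷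
  (548323 , 123) ∷ (580291 , 127) ∷ (613699 , 130) ∷ (649483 , 134) ∷ (687139 , 138) ∷ (726811 , 142) ∷ (769147 , 146) ∷
  (814003 , 150) ∷ (861163 , 154) ∷ (911419 , 159) ∷ (964339 , 163) ∷ (1019563 , 168) ∷ (1078387 , 173) ∷ (1141243 , 178) ∷
  (1207699 , 183) ∷ (1277971 , 188) ∷ (1352419 , 193) ∷ (1430971 , 199) ∷ (1514131 , 205) ∷ (1602187 , 211) ∷ (1695643 , 217) ∷
  (1794427 , 223) ∷ (1899187 , 229) ∷ (2009923 , 236) ∷ (2127067 , 243) ∷ (2250979 , 250) ∷ (2382307 , 257) ∷ (2521339 , 264) ∷
  (2668363 , 272) ∷ (2823811 , 280) ∷ (2988619 , 288) ∷ (3162787 , 296) ∷ (3347251 , 305) ∷ (3542083 , 313) ∷ (3748939 , 322) ∷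
  (3967819 , 332) ∷ (4198003 , 341) ∷ (4442443 , 351) ∷ (4701787 , 361) ∷ (4976107 , 371) ∷ (5266483 , 382) ∷ (5573779 , 393) ∷
  (5898931 , 404) ∷ (6243379 , 416) ∷ (6606331 , 428) ∷ (6991819 , 440) ∷ (7399771 , 453) ∷ (7831771 , 466) ∷ (8288899 , 480) ∷
  (8772739 , 493) ∷ (9284371 , 508) ∷ (9826171 , 522) ∷ (10399723 , 537) ∷ (11007043 , 553) ∷ (11649787 , 569) ∷ (12329683 , 585) ∷
  (13049611 , 602) ∷ (13811587 , 619) ∷ (14617843 , 637) ∷ (15471331 , 655) ∷ (16374571 , 674) ∷ (17330227 , 693) ∷ (18342043 , 713) ∷
  (19413187 , 734) ∷ (20546683 , 755) ∷ (21746563 , 777) ∷ (23016067 , 799) ∷ (24359947 , 822) ∷ (25782307 , 846) ∷ (27287539 , 870) ∷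
  (28880827 , 895) ∷ (30566923 , 921) ∷ (32351947 , 948) ∷ (34239859 , 975) ∷ (36239443 , 1003) ∷ (38355739 , 1032) ∷ (40595083 , 1062) ∷
  (42965539 , 1092) ∷ (45473803 , 1124) ∷ (48129379 , 1156) ∷ (50939683 , 1189) ∷ (53913571 , 1223) ∷ (57062059 , 1259) ∷ (60394363 , 1295) ∷
  (63920347 , 1332) ∷ (67653043 , 1371) ∷ (71603827 , 1410) ∷ (75785011 , 1451) ∷ (80209627 , 1492) ∷ (84893587 , 1535) ∷ (89851291 , 1579) ∷
  (95098579 , 1625) ∷ (100651939 , 1672) ∷ (106529659 , 1720) ∷ (112750819 , 1769) ∷ (119335147 , 1820) ∷ (126303379 , 1873) ∷ (133678843 , 1927) ∷
  (141485587 , 1982) ∷ (149748307 , 2039) ∷ (158493211 , 2098) ∷ (167748307 , 2158) ∷ (177544771 , 2220) ∷ (187912987 , 2284) ∷ (198886651 , 2350) ∷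
  (210501619 , 2418) ∷ (222794827 , 2487) ∷ (235805803 , 2559) ∷ (249576451 , 2633) ∷ (264151339 , 2708) ∷ (279576691 , 2786) ∷ (295903771 , 2867) ∷
  (313184059 , 2949) ∷ (331473931 , 3034) ∷ (350831419 , 3121) ∷ (371319811 , 3211) ∷ (393004627 , 3304) ∷ (415955131 , 3399) ∷ (440246203 , 3497) ∷
  (465956539 , 3597) ∷ (493168219 , 3701) ∷ (521968939 , 3807) ∷ (552451579 , 3917) ∷ (584713411 , 4030) ∷ (618860491 , 4146) ∷ (655001899 , 4265) ∷
  (693253411 , 4388) ∷ (733739299 , 4514) ∷ (776589523 , 4644) ∷ (821941963 , 4778) ∷ (869943211 , 4915) ∷ (920747059 , 5057) ∷ (974518459 , 5203) ∷
  (1031429059 , 5352) ∷ (1091664403 , 5506) ∷ (1155417163 , 5665) ∷ (1222893403 , 5828) ∷ (1294310131 , 5996) ∷ (1369897747 , 6168) ∷ (1449899611 , 6346) ∷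
  (1534572619 , 6529) ∷ (1624191523 , 6717) ∷ (1719043819 , 6910) ∷ (1819435507 , 7109) ∷ (1925690443 , 7313) ∷ (2038150627 , 7524) ∷ (2157178147 , 7741) ∷
  (2283155899 , 7963) ∷ (2416492051 , 8193) ∷ (2557614211 , 8428) ∷ (2706978787 , 8671) ∷ (2865065443 , 8921) ∷ (3032383723 , 9178) ∷ (3209474563 , 9442) ∷
  (3396907771 , 9713) ∷ (3595286347 , 9993) ∷ (3805250731 , 10281) ∷ (4027477219 , 10577) ∷ (4262681707 , 10881) ∷ (4511621923 , 11194) ∷ (4775100091 , 11517) ∷
  (5053965019 , 11848) ∷ (5349116347 , 12189) ∷ (5661504547 , 12540) ∷ (5992135531 , 12901) ∷ (6342075979 , 13273) ∷ (6712453051 , 13655) ∷ (7104459931 , 14048) ∷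
  (7519360003 , 14452) ∷ (7958490451 , 14868) ∷ (8423265139 , 15296) ∷ (8915182747 , 15736) ∷ (9435829003 , 16189) ∷ (9986880859 , 16655) ∷ (10570114483 , 17135) ∷ []

chain47 : Vec Entry 237
chain47 =
  (18911 , 23) ∷ (19991 , 23) ∷ (21143 , 24) ∷ (22367 , 25) ∷ (23663 , 25) ∷ (25031 , 26) ∷ (26399 , 27) ∷
  (27767 , 27) ∷ (29207 , 28) ∷ (30431 , 29) ∷ (32159 , 30) ∷ (34031 , 30) ∷ (35831 , 31) ∷ (37847 , 32) ∷
  (39863 , 33) ∷ (42023 , 34) ∷ (44111 , 35) ∷ (46559 , 36) ∷ (49223 , 37) ∷ (51599 , 38) ∷ (53831 , 38) ∷
  (56783 , 39) ∷ (59951 , 40) ∷ (62903 , 41) ∷ (66431 , 43) ∷ (69959 , 44) ∷ (73847 , 45) ∷ (77951 , 46) ∷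
  (82487 , 48) ∷ (86951 , 49) ∷ (91703 , 50) ∷ (96959 , 52) ∷ (102503 , 53) ∷ (108263 , 55) ∷ (114311 , 56) ∷
  (120863 , 58) ∷ (127703 , 59) ∷ (135119 , 61) ∷ (142607 , 63) ∷ (150743 , 64) ∷ (159311 , 66) ∷ (168599 , 68) ∷
  (178247 , 70) ∷ (187823 , 72) ∷ (198623 , 74) ∷ (210143 , 76) ∷ (222311 , 78) ∷ (235199 , 80) ∷ (248879 , 83) ∷
  (263063 , 85) ∷ (278111 , 88) ∷ (294311 , 90) ∷ (311447 , 93) ∷ (329591 , 95) ∷ (348671 , 98) ∷ (368471 , 101) ∷
  (389927 , 104) ∷ (412463 , 107) ∷ (436439 , 110) ∷ (461639 , 113) ∷ (488567 , 116) ∷ (517079 , 120) ∷ (547103 , 123) ∷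
  (578999 , 126) ∷ (612407 , 130) ∷ (648119 , 134) ∷ (685631 , 138) ∷ (725663 , 142) ∷ (767783 , 146) ∷ (812351 , 150) ∷
  (859223 , 154) ∷ (909119 , 159) ∷ (961679 , 163) ∷ (1017623 , 168) ∷ (1077023 , 173) ∷ (1139807 , 178) ∷ (1206263 , 183) ∷
  (1276679 , 188) ∷ (1351199 , 193) ∷ (1429319 , 199) ∷ (1512767 , 205) ∷ (1600967 , 211) ∷ (1694423 , 217) ∷ (1792991 , 223) ∷
  (1896959 , 229) ∷ (2007623 , 236) ∷ (2124839 , 243) ∷ (2248679 , 250) ∷ (2379791 , 257) ∷ (2518391 , 264) ∷ (2665343 , 272) ∷
  (2820863 , 280) ∷ (2984951 , 288) ∷ (3158759 , 296) ∷ (3342719 , 304) ∷ (3537551 , 313) ∷ (3743903 , 322) ∷ (3962351 , 331) ∷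
  (4193327 , 341) ∷ (4438199 , 351) ∷ (4697327 , 361) ∷ (4971287 , 371) ∷ (5261519 , 382) ∷ (5568383 , 393) ∷ (5893319 , 404) ∷
  (6237191 , 416) ∷ (6601223 , 428) ∷ (6986423 , 440) ∷ (7392719 , 453) ∷ (7823423 , 466) ∷ (8280263 , 479) ∷ (8763527 , 493) ∷
  (9274871 , 507) ∷ (9816167 , 522) ∷ (10387919 , 537) ∷ (10994447 , 552) ∷ (11636327 , 568) ∷ (12315647 , 585) ∷ (13034423 , 601) ∷
  (13795247 , 619) ∷ (14600711 , 637) ∷ (15452903 , 655) ∷ (16354487 , 674) ∷ (17309351 , 693) ∷ (18319583 , 713) ∷ (19388783 , 734) ∷
  (20520767 , 755) ∷ (21719063 , 776) ∷ (22987271 , 799) ∷ (24329639 , 822) ∷ (25750343 , 845) ∷ (27254063 , 870) ∷ (28845119 , 895) ∷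
  (30528623 , 921) ∷ (32311199 , 947) ∷ (34198103 , 974) ∷ (36195239 , 1002) ∷ (38308511 , 1031) ∷ (40545623 , 1061) ∷ (42913487 , 1091) ∷
  (45419303 , 1123) ∷ (48071567 , 1155) ∷ (50877767 , 1188) ∷ (53848199 , 1223) ∷ (56992151 , 1258) ∷ (60320279 , 1294) ∷ (63842879 , 1331) ∷
  (67571183 , 1370) ∷ (71517287 , 1409) ∷ (75693791 , 1450) ∷ (80114159 , 1491) ∷ (84792791 , 1534) ∷ (89744519 , 1579) ∷ (94985183 , 1624) ∷
  (100532279 , 1671) ∷ (106402871 , 1719) ∷ (112616039 , 1768) ∷ (119192807 , 1819) ∷ (126153263 , 1872) ∷ (133519871 , 1926) ∷ (141317399 , 1981) ∷
  (149570327 , 2038) ∷ (158305151 , 2097) ∷ (167549951 , 2157) ∷ (177334319 , 2219) ∷ (187690583 , 2283) ∷ (198651071 , 2349) ∷ (210252143 , 2416) ∷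
  (222530447 , 2486) ∷ (235526087 , 2557) ∷ (249280751 , 2631) ∷ (263838719 , 2707) ∷ (279246647 , 2785) ∷ (295554359 , 2865) ∷ (312813911 , 2947) ∷
  (331081967 , 3032) ∷ (350416127 , 3120) ∷ (370880327 , 3209) ∷ (392539223 , 3302) ∷ (415463231 , 3397) ∷ (439726223 , 3495) ∷ (465406031 , 3595) ∷
  (492585671 , 3699) ∷ (521352551 , 3805) ∷ (551799407 , 3915) ∷ (584023439 , 4027) ∷ (618130343 , 4143) ∷ (654228983 , 4263) ∷ (692434703 , 4385) ∷
  (732872783 , 4512) ∷ (775672463 , 4641) ∷ (820971623 , 4775) ∷ (868915991 , 4913) ∷ (919659647 , 5054) ∷ (973366607 , 5199) ∷ (1030211183 , 5349) ∷
  (1090375463 , 5503) ∷ (1154052047 , 5662) ∷ (1221448439 , 5825) ∷ (1292780927 , 5992) ∷ (1368278831 , 6165) ∷ (1448185223 , 6342) ∷ (1532759087 , 6525) ∷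
  (1622271143 , 6713) ∷ (1717011767 , 6906) ∷ (1817285231 , 7105) ∷ (1923414239 , 7309) ∷ (2035741223 , 7520) ∷ (2154625247 , 7736) ∷ (2280454247 , 7959) ∷
  (2413632071 , 8188) ∷ (2554587911 , 8423) ∷ (2703775583 , 8666) ∷ (2861675903 , 8915) ∷ (3028797263 , 9172) ∷ (3205678799 , 9436) ∷ (3392890031 , 9708) ∷
  (3591034679 , 9987) ∷ (3800750879 , 10275) ∷ (4022714711 , 10570) ∷ (4257640991 , 10875) ∷ (4506286439 , 11188) ∷ (4769453279 , 11510) ∷ (5047988807 , 11841) ∷
  (5342790863 , 12182) ∷ (5654809487 , 12533) ∷ (5985049727 , 12894) ∷ (6334576463 , 13265) ∷ (6704515487 , 13647) ∷ (7096058759 , 14039) ∷ (7510468583 , 14443) ∷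
  (7949079911 , 14859) ∷ (8413305599 , 15287) ∷ (8904642023 , 15727) ∷ (9424672031 , 16180) ∷ (9975072431 , 16646) ∷ (10557615863 , 17125) ∷ []

chain49 : Vec Entry 236
chain49 =
  (19489 , 23) ∷ (20353 , 23) ∷ (21433 , 24) ∷ (22441 , 25) ∷ (23593 , 25) ∷ (24889 , 26) ∷ (26113 , 27) ∷
  (27481 , 27) ∷ (28921 , 28) ∷ (30577 , 29) ∷ (32233 , 30) ∷ (34033 , 30) ∷ (35977 , 31) ∷ (37993 , 32) ∷
  (40153 , 33) ∷ (42457 , 34) ∷ (44617 , 35) ∷ (47137 , 36) ∷ (49801 , 37) ∷ (52609 , 38) ∷ (55633 , 39) ∷
  (58657 , 40) ∷ (61681 , 41) ∷ (64921 , 42) ∷ (68521 , 43) ∷ (72481 , 45) ∷ (76441 , 46) ∷ (80833 , 47) ∷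
  (85513 , 48) ∷ (90481 , 50) ∷ (95737 , 51) ∷ (101281 , 53) ∷ (106753 , 54) ∷ (112657 , 56) ∷ (118633 , 57) ∷
  (125329 , 59) ∷ (132529 , 60) ∷ (139801 , 62) ∷ (147937 , 64) ∷ (156361 , 66) ∷ (165001 , 67) ∷ (174289 , 69) ∷
  (184441 , 71) ∷ (194809 , 73) ∷ (205537 , 75) ∷ (217489 , 77) ∷ (230089 , 80) ∷ (243121 , 82) ∷ (257161 , 84) ∷
  (271849 , 87) ∷ (287689 , 89) ∷ (304393 , 92) ∷ (321961 , 94) ∷ (340393 , 97) ∷ (360193 , 100) ∷ (381001 , 103) ∷
  (402817 , 105) ∷ (426073 , 108) ∷ (450913 , 112) ∷ (476977 , 115) ∷ (504337 , 118) ∷ (533713 , 121) ∷ (564457 , 125) ∷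
  (597361 , 128) ∷ (632209 , 132) ∷ (668929 , 136) ∷ (707953 , 140) ∷ (749209 , 144) ∷ (792769 , 148) ∷ (838993 , 152) ∷
  (887449 , 157) ∷ (938857 , 161) ∷ (993217 , 166) ∷ (1051177 , 171) ∷ (1112017 , 175) ∷ (1176673 , 180) ∷ (1245217 , 186) ∷
  (1317793 , 191) ∷ (1394401 , 196) ∷ (1475833 , 202) ∷ (1561801 , 208) ∷ (1652881 , 214) ∷ (1749217 , 220) ∷ (1851313 , 226) ∷
  (1959313 , 233) ∷ (2073649 , 240) ∷ (2194537 , 247) ∷ (2322409 , 254) ∷ (2457337 , 261) ∷ (2600761 , 268) ∷ (2752609 , 276) ∷
  (2913241 , 284) ∷ (3083233 , 292) ∷ (3263233 , 301) ∷ (3453673 , 309) ∷ (3654913 , 318) ∷ (3868321 , 327) ∷ (4094113 , 337) ∷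
  (4333081 , 347) ∷ (4586017 , 357) ∷ (4852849 , 367) ∷ (5135953 , 377) ∷ (5435401 , 388) ∷ (5752561 , 399) ∷ (6088441 , 411) ∷
  (6443977 , 423) ∷ (6819313 , 435) ∷ (7216609 , 447) ∷ (7637953 , 460) ∷ (8083849 , 474) ∷ (8555881 , 487) ∷ (9055201 , 501) ∷
  (9583537 , 516) ∷ (10142617 , 530) ∷ (10734817 , 546) ∷ (11361001 , 561) ∷ (12024409 , 578) ∷ (12725689 , 594) ∷ (13468801 , 611) ∷
  (14255113 , 629) ∷ (15087433 , 647) ∷ (15968209 , 666) ∷ (16900537 , 685) ∷ (17887369 , 705) ∷ (18931513 , 725) ∷ (20035993 , 746) ∷
  (21205993 , 767) ∷ (22444393 , 789) ∷ (23754937 , 812) ∷ (25141873 , 835) ∷ (26609953 , 859) ∷ (28163929 , 884) ∷ (29808553 , 910) ∷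
  (31549081 , 936) ∷ (33391201 , 963) ∷ (35340457 , 990) ∷ (37404337 , 1019) ∷ (39588169 , 1048) ∷ (41899801 , 1079) ∷ (44346649 , 1110) ∷
  (46936489 , 1142) ∷ (49676881 , 1174) ∷ (52577257 , 1208) ∷ (55647049 , 1243) ∷ (58896697 , 1279) ∷ (62335849 , 1316) ∷ (65976241 , 1353) ∷
  (69828313 , 1392) ∷ (73906177 , 1432) ∷ (78222073 , 1474) ∷ (82789321 , 1516) ∷ (87624049 , 1560) ∷ (92740873 , 1605) ∷ (98156857 , 1651) ∷
  (103889209 , 1698) ∷ (109956001 , 1747) ∷ (116376961 , 1798) ∷ (123173329 , 1849) ∷ (130366057 , 1903) ∷ (137979409 , 1957) ∷ (146037289 , 2014) ∷
  (154565833 , 2072) ∷ (163591609 , 2131) ∷ (173143921 , 2193) ∷ (183255169 , 2256) ∷ (193957033 , 2321) ∷ (205283569 , 2388) ∷ (217271209 , 2456) ∷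
  (229959553 , 2527) ∷ (243388777 , 2600) ∷ (257601793 , 2675) ∷ (272645257 , 2752) ∷ (288567121 , 2831) ∷ (305418937 , 2912) ∷ (323254417 , 2996) ∷
  (342132097 , 3082) ∷ (362111521 , 3171) ∷ (383258713 , 3262) ∷ (405640561 , 3356) ∷ (429329497 , 3453) ∷ (454401697 , 3552) ∷ (480937801 , 3655) ∷
  (509024209 , 3760) ∷ (538750273 , 3868) ∷ (570212473 , 3980) ∷ (603512761 , 4094) ∷ (638757841 , 4212) ∷ (676061041 , 4333) ∷ (715542097 , 4458) ∷
  (757329673 , 4586) ∷ (801557041 , 4718) ∷ (848367193 , 4854) ∷ (897911761 , 4994) ∷ (950349721 , 5138) ∷ (1005849913 , 5286) ∷ (1064591401 , 5438) ∷
  (1126761817 , 5594) ∷ (1192564273 , 5755) ∷ (1262209873 , 5921) ∷ (1335922681 , 6091) ∷ (1413940513 , 6267) ∷ (1496514577 , 6447) ∷ (1583910697 , 6633) ∷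
  (1676410753 , 6824) ∷ (1774313041 , 7020) ∷ (1877932921 , 7222) ∷ (1987603393 , 7430) ∷ (2103679129 , 7644) ∷ (2226533521 , 7864) ∷ (2356562641 , 8090) ∷
  (2494185313 , 8323) ∷ (2639845489 , 8563) ∷ (2794012393 , 8809) ∷ (2957182609 , 9063) ∷ (3129881017 , 9324) ∷ (3312665977 , 9592) ∷ (3506125153 , 9868) ∷
  (3710882641 , 10153) ∷ (3927597313 , 10445) ∷ (4156968577 , 10745) ∷ (4399735441 , 11055) ∷ (4656679249 , 11373) ∷ (4928629297 , 11700) ∷ (5216460673 , 12037) ∷
  (5521101097 , 12384) ∷ (5843533081 , 12740) ∷ (6184795081 , 13107) ∷ (6545986393 , 13484) ∷ (6928271689 , 13872) ∷ (7332882457 , 14272) ∷ (7761122113 , 14683) ∷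
  (8214370393 , 15105) ∷ (8694089617 , 15540) ∷ (9201824041 , 15987) ∷ (9739210153 , 16448) ∷ (10307979337 , 16921) ∷ []

chain53 : Vec Entry 237
chain53 =
  (19421 , 23) ∷ (20357 , 23) ∷ (21221 , 24) ∷ (22229 , 25) ∷ (23021 , 25) ∷ (24317 , 26) ∷ (25541 , 26) ∷
  (26981 , 27) ∷ (28493 , 28) ∷ (29789 , 28) ∷ (31517 , 29) ∷ (33317 , 30) ∷ (35117 , 31) ∷ (37061 , 32) ∷
  (38933 , 33) ∷ (40949 , 33) ∷ (43037 , 34) ∷ (45413 , 35) ∷ (47933 , 36) ∷ (50093 , 37) ∷ (52973 , 38) ∷
  (55997 , 39) ∷ (59093 , 40) ∷ (62477 , 41) ∷ (65789 , 42) ∷ (69389 , 44) ∷ (73421 , 45) ∷ (77237 , 46) ∷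
  (81701 , 47) ∷ (86453 , 49) ∷ (91493 , 50) ∷ (96821 , 52) ∷ (102437 , 53) ∷ (108413 , 55) ∷ (113957 , 56) ∷
  (120293 , 57) ∷ (127277 , 59) ∷ (134333 , 61) ∷ (141677 , 62) ∷ (149381 , 64) ∷ (157877 , 66) ∷ (167021 , 68) ∷
  (176741 , 70) ∷ (186317 , 72) ∷ (197117 , 74) ∷ (208493 , 76) ∷ (220589 , 78) ∷ (233117 , 80) ∷ (246509 , 82) ∷
  (260549 , 85) ∷ (275741 , 87) ∷ (291509 , 90) ∷ (308501 , 92) ∷ (326141 , 95) ∷ (344429 , 97) ∷ (364373 , 100) ∷
  (385397 , 103) ∷ (407861 , 106) ∷ (431621 , 109) ∷ (456821 , 112) ∷ (483389 , 116) ∷ (511541 , 119) ∷ (541349 , 122) ∷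
  (572813 , 126) ∷ (606077 , 129) ∷ (641213 , 133) ∷ (678653 , 137) ∷ (717533 , 141) ∷ (759293 , 145) ∷ (803501 , 149) ∷
  (850373 , 153) ∷ (899981 , 158) ∷ (952397 , 162) ∷ (1007693 , 167) ∷ (1066517 , 172) ∷ (1128509 , 177) ∷ (1193741 , 182) ∷
  (1263077 , 187) ∷ (1336589 , 192) ∷ (1413773 , 198) ∷ (1496141 , 204) ∷ (1583117 , 209) ∷ (1675133 , 215) ∷ (1772333 , 222) ∷
  (1875149 , 228) ∷ (1984013 , 234) ∷ (2099717 , 241) ∷ (2222333 , 248) ∷ (2351501 , 255) ∷ (2487581 , 263) ∷ (2631653 , 270) ∷
  (2785301 , 278) ∷ (2947949 , 286) ∷ (3119957 , 294) ∷ (3301901 , 303) ∷ (3494573 , 311) ∷ (3698117 , 320) ∷ (3913541 , 329) ∷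
  (4141853 , 339) ∷ (4383629 , 349) ∷ (4639373 , 359) ∷ (4909301 , 369) ∷ (5195789 , 380) ∷ (5498981 , 390) ∷ (5819813 , 402) ∷
  (6159509 , 413) ∷ (6518933 , 425) ∷ (6899597 , 437) ∷ (7302509 , 450) ∷ (7728533 , 463) ∷ (8179757 , 476) ∷ (8657333 , 490) ∷
  (9162773 , 504) ∷ (9697301 , 519) ∷ (10263293 , 534) ∷ (10862333 , 549) ∷ (11496509 , 565) ∷ (12167333 , 581) ∷ (12877757 , 598) ∷
  (13629509 , 615) ∷ (14425109 , 633) ∷ (15267437 , 651) ∷ (16158941 , 670) ∷ (17102573 , 689) ∷ (18100853 , 709) ∷ (19157381 , 729) ∷
  (20275613 , 750) ∷ (21459653 , 772) ∷ (22712813 , 794) ∷ (24039053 , 817) ∷ (25442621 , 840) ∷ (26927909 , 865) ∷ (28500389 , 889) ∷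
  (30164597 , 915) ∷ (31926077 , 941) ∷ (33789941 , 968) ∷ (35763173 , 996) ∷ (37851677 , 1025) ∷ (40061717 , 1055) ∷ (42401069 , 1085) ∷
  (44877149 , 1116) ∷ (47497733 , 1148) ∷ (50271029 , 1181) ∷ (53205821 , 1215) ∷ (56312621 , 1250) ∷ (59601149 , 1286) ∷ (63081413 , 1323) ∷
  (66764861 , 1361) ∷ (70663877 , 1401) ∷ (74790557 , 1441) ∷ (79158077 , 1483) ∷ (83780621 , 1525) ∷ (88672877 , 1569) ∷ (93851333 , 1614) ∷
  (99331541 , 1661) ∷ (105131933 , 1709) ∷ (111271373 , 1758) ∷ (117769373 , 1808) ∷ (124647101 , 1860) ∷ (131926373 , 1914) ∷ (139630013 , 1969) ∷
  (147783869 , 2026) ∷ (156413861 , 2084) ∷ (165547061 , 2144) ∷ (175214357 , 2206) ∷ (185445773 , 2269) ∷ (196275797 , 2335) ∷ (207738197 , 2402) ∷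
  (219869693 , 2471) ∷ (232709669 , 2542) ∷ (246299597 , 2615) ∷ (260683109 , 2691) ∷ (275906573 , 2768) ∷ (292018949 , 2848) ∷ (309072653 , 2930) ∷
  (327121469 , 3014) ∷ (346224653 , 3101) ∷ (366444053 , 3190) ∷ (387843893 , 3282) ∷ (410493653 , 3376) ∷ (434466413 , 3474) ∷ (459839141 , 3574) ∷
  (486692981 , 3677) ∷ (515115773 , 3782) ∷ (545197517 , 3891) ∷ (577036853 , 4003) ∷ (610735661 , 4119) ∷ (646402157 , 4237) ∷ (684151541 , 4359) ∷
  (724104917 , 4485) ∷ (766391957 , 4614) ∷ (811149173 , 4746) ∷ (858519989 , 4883) ∷ (908657549 , 5024) ∷ (961722917 , 5168) ∷ (1017887237 , 5317) ∷
  (1077331517 , 5470) ∷ (1140247421 , 5628) ∷ (1206837773 , 5790) ∷ (1277316917 , 5956) ∷ (1351911941 , 6128) ∷ (1430862533 , 6304) ∷ (1514424077 , 6486) ∷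
  (1602865421 , 6672) ∷ (1696472693 , 6864) ∷ (1795546637 , 7062) ∷ (1900406357 , 7265) ∷ (2011388957 , 7474) ∷ (2128853717 , 7690) ∷ (2253177701 , 7911) ∷
  (2384762957 , 8139) ∷ (2524032629 , 8373) ∷ (2671435493 , 8614) ∷ (2827447037 , 8862) ∷ (2992569677 , 9117) ∷ (3167335709 , 9380) ∷ (3352306733 , 9650) ∷
  (3548080637 , 9927) ∷ (3755287853 , 10213) ∷ (3974596469 , 10507) ∷ (4206712589 , 10810) ∷ (4452383933 , 11121) ∷ (4712402789 , 11441) ∷ (4987606733 , 11770) ∷
  (5278880141 , 12109) ∷ (5587166573 , 12458) ∷ (5913457037 , 12816) ∷ (6258802373 , 13185) ∷ (6624315413 , 13565) ∷ (7011174941 , 13955) ∷ (7420627349 , 14357) ∷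
  (7853991749 , 14770) ∷ (8312664221 , 15195) ∷ (8798123069 , 15633) ∷ (9311932493 , 16083) ∷ (9855749213 , 16546) ∷ (10431323333 , 17022) ∷ []

chain55 : Vec Entry 237
chain55 =
  (19423 , 23) ∷ (20431 , 23) ∷ (20719 , 24) ∷ (21871 , 24) ∷ (22807 , 25) ∷ (24103 , 26) ∷ (25471 , 26) ∷
  (26839 , 27) ∷ (28351 , 28) ∷ (29863 , 28) ∷ (31231 , 29) ∷ (32887 , 30) ∷ (34759 , 31) ∷ (36559 , 32) ∷
  (38431 , 32) ∷ (40591 , 33) ∷ (42751 , 34) ∷ (45127 , 35) ∷ (47431 , 36) ∷ (50023 , 37) ∷ (52903 , 38) ∷
  (55927 , 39) ∷ (59167 , 40) ∷ (62191 , 41) ∷ (65719 , 42) ∷ (69463 , 44) ∷ (73351 , 45) ∷ (77527 , 46) ∷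
  (81919 , 47) ∷ (86599 , 49) ∷ (91639 , 50) ∷ (96823 , 52) ∷ (102367 , 53) ∷ (108343 , 55) ∷ (114319 , 56) ∷
  (120943 , 58) ∷ (127711 , 59) ∷ (134839 , 61) ∷ (142543 , 63) ∷ (150607 , 64) ∷ (159319 , 66) ∷ (168463 , 68) ∷
  (178183 , 70) ∷ (188407 , 72) ∷ (199207 , 74) ∷ (209719 , 76) ∷ (221671 , 78) ∷ (234343 , 80) ∷ (247879 , 83) ∷
  (262351 , 85) ∷ (277183 , 87) ∷ (293311 , 90) ∷ (310231 , 92) ∷ (328303 , 95) ∷ (347239 , 98) ∷ (366967 , 101) ∷
  (388351 , 104) ∷ (410671 , 106) ∷ (434647 , 110) ∷ (459847 , 113) ∷ (486559 , 116) ∷ (514783 , 119) ∷ (544807 , 123) ∷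
  (575623 , 126) ∷ (608887 , 130) ∷ (644383 , 133) ∷ (681823 , 137) ∷ (721351 , 141) ∷ (763471 , 145) ∷ (808039 , 149) ∷
  (855199 , 154) ∷ (904879 , 158) ∷ (956503 , 163) ∷ (1012159 , 167) ∷ (1069687 , 172) ∷ (1131751 , 177) ∷ (1197631 , 182) ∷
  (1267183 , 187) ∷ (1340767 , 193) ∷ (1418959 , 198) ∷ (1501471 , 204) ∷ (1588879 , 210) ∷ (1680967 , 216) ∷ (1778743 , 222) ∷
  (1882207 , 228) ∷ (1992079 , 235) ∷ (2107999 , 242) ∷ (2230759 , 249) ∷ (2360719 , 256) ∷ (2498527 , 263) ∷ (2644399 , 271) ∷
  (2798767 , 278) ∷ (2962207 , 287) ∷ (3135151 , 295) ∷ (3318031 , 303) ∷ (3511567 , 312) ∷ (3716623 , 321) ∷ (3933343 , 330) ∷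
  (4162591 , 340) ∷ (4405591 , 349) ∷ (4662631 , 360) ∷ (4934863 , 370) ∷ (5223007 , 381) ∷ (5527927 , 392) ∷ (5850631 , 403) ∷
  (6192127 , 414) ∷ (6553567 , 426) ∷ (6936247 , 439) ∷ (7341247 , 451) ∷ (7769647 , 464) ∷ (8222959 , 478) ∷ (8702839 , 491) ∷
  (9210871 , 505) ∷ (9748423 , 520) ∷ (10317583 , 535) ∷ (10919791 , 550) ∷ (11557423 , 566) ∷ (12232351 , 583) ∷ (12946663 , 599) ∷
  (13702519 , 617) ∷ (14502727 , 634) ∷ (15349591 , 653) ∷ (16245919 , 671) ∷ (17194591 , 691) ∷ (18198343 , 711) ∷ (19260919 , 731) ∷
  (20385559 , 752) ∷ (21575791 , 774) ∷ (22835719 , 796) ∷ (24168943 , 819) ∷ (25580143 , 843) ∷ (27073999 , 867) ∷ (28654543 , 892) ∷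
  (30327967 , 918) ∷ (32098879 , 944) ∷ (33973399 , 971) ∷ (35956351 , 999) ∷ (38055439 , 1028) ∷ (40277791 , 1057) ∷ (42629887 , 1088) ∷
  (45119143 , 1119) ∷ (47753767 , 1151) ∷ (50542399 , 1185) ∷ (53493751 , 1219) ∷ (56615527 , 1254) ∷ (59921479 , 1290) ∷ (63420751 , 1327) ∷
  (67124287 , 1365) ∷ (71043319 , 1404) ∷ (75192031 , 1445) ∷ (79582879 , 1486) ∷ (84229903 , 1529) ∷ (89148727 , 1573) ∷ (94354903 , 1619) ∷
  (99864559 , 1665) ∷ (105696631 , 1713) ∷ (111869047 , 1762) ∷ (118401607 , 1813) ∷ (125314687 , 1865) ∷ (132632839 , 1919) ∷ (140377807 , 1974) ∷
  (148575151 , 2031) ∷ (157251727 , 2090) ∷ (166434967 , 2150) ∷ (176154751 , 2212) ∷ (186441823 , 2275) ∷ (197329879 , 2341) ∷ (208853839 , 2408) ∷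
  (221049847 , 2478) ∷ (233958871 , 2549) ∷ (247621159 , 2622) ∷ (262081423 , 2698) ∷ (277386103 , 2775) ∷ (293585023 , 2855) ∷ (310730311 , 2938) ∷
  (328876759 , 3022) ∷ (348082543 , 3109) ∷ (368410303 , 3199) ∷ (389925199 , 3291) ∷ (412696783 , 3385) ∷ (436797919 , 3483) ∷ (462306151 , 3583) ∷
  (489304423 , 3686) ∷ (517879423 , 3792) ∷ (548123311 , 3902) ∷ (580132711 , 4014) ∷ (614012383 , 4130) ∷ (649870687 , 4248) ∷ (687822463 , 4371) ∷
  (727991191 , 4497) ∷ (770505607 , 4626) ∷ (815502943 , 4759) ∷ (863127919 , 4896) ∷ (913533679 , 5037) ∷ (966882223 , 5182) ∷ (1023347863 , 5331) ∷
  (1083110887 , 5485) ∷ (1146363247 , 5643) ∷ (1213310431 , 5805) ∷ (1284166783 , 5972) ∷ (1359161983 , 6144) ∷ (1438536439 , 6321) ∷ (1522546903 , 6503) ∷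
  (1611463591 , 6690) ∷ (1705571911 , 6883) ∷ (1805177071 , 7081) ∷ (1910598607 , 7285) ∷ (2022176287 , 7494) ∷ (2140271191 , 7710) ∷ (2265262759 , 7932) ∷
  (2397553831 , 8160) ∷ (2537570719 , 8395) ∷ (2685764071 , 8637) ∷ (2842611823 , 8886) ∷ (3008619631 , 9141) ∷ (3184322959 , 9405) ∷ (3370287007 , 9675) ∷
  (3567111391 , 9954) ∷ (3775429927 , 10240) ∷ (3995913511 , 10535) ∷ (4229274583 , 10838) ∷ (4476262591 , 11150) ∷ (4737675367 , 11471) ∷ (5014355239 , 11802) ∷
  (5307192559 , 12141) ∷ (5617132039 , 12491) ∷ (5945172031 , 12850) ∷ (6292369639 , 13220) ∷ (6659843599 , 13601) ∷ (7048778383 , 13993) ∷ (7460426647 , 14395) ∷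
  (7896115207 , 14810) ∷ (8357247631 , 15236) ∷ (8845310791 , 15675) ∷ (9361876807 , 16126) ∷ (9908609671 , 16590) ∷ (10487272087 , 17068) ∷ []

chain59 : Vec Entry 236
chain59 =
  (19427 , 23) ∷ (20507 , 24) ∷ (21587 , 24) ∷ (22811 , 25) ∷ (24107 , 26) ∷ (24971 , 26) ∷ (26339 , 27) ∷
  (27851 , 27) ∷ (29363 , 28) ∷ (31019 , 29) ∷ (32603 , 30) ∷ (34403 , 31) ∷ (36131 , 31) ∷ (38219 , 32) ∷
  (40163 , 33) ∷ (42467 , 34) ∷ (44843 , 35) ∷ (47363 , 36) ∷ (49811 , 37) ∷ (52691 , 38) ∷ (54851 , 39) ∷
  (57947 , 40) ∷ (61331 , 41) ∷ (64499 , 42) ∷ (68171 , 43) ∷ (71987 , 44) ∷ (76163 , 46) ∷ (80051 , 47) ∷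
  (84659 , 48) ∷ (89123 , 49) ∷ (94307 , 51) ∷ (99707 , 52) ∷ (105467 , 54) ∷ (111443 , 55) ∷ (117851 , 57) ∷
  (123323 , 58) ∷ (130523 , 60) ∷ (137867 , 62) ∷ (145643 , 63) ∷ (154067 , 65) ∷ (162779 , 67) ∷ (172283 , 69) ∷
  (181931 , 71) ∷ (191579 , 73) ∷ (202667 , 75) ∷ (214259 , 77) ∷ (226643 , 79) ∷ (239531 , 81) ∷ (253427 , 84) ∷
  (268043 , 86) ∷ (283163 , 88) ∷ (299363 , 91) ∷ (316571 , 93) ∷ (334931 , 96) ∷ (354443 , 99) ∷ (374819 , 102) ∷
  (396563 , 105) ∷ (419603 , 108) ∷ (443939 , 111) ∷ (469787 , 114) ∷ (496499 , 117) ∷ (525299 , 120) ∷ (555827 , 124) ∷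
  (588083 , 127) ∷ (622067 , 131) ∷ (658211 , 135) ∷ (696083 , 139) ∷ (736691 , 143) ∷ (779531 , 147) ∷ (824531 , 151) ∷
  (872411 , 155) ∷ (923171 , 160) ∷ (976883 , 164) ∷ (1032683 , 169) ∷ (1092803 , 174) ∷ (1156523 , 179) ∷ (1224059 , 184) ∷
  (1295339 , 189) ∷ (1370723 , 195) ∷ (1450571 , 200) ∷ (1535243 , 206) ∷ (1624811 , 212) ∷ (1719491 , 218) ∷ (1819283 , 224) ∷
  (1924619 , 231) ∷ (2036939 , 238) ∷ (2155883 , 244) ∷ (2281739 , 251) ∷ (2414507 , 259) ∷ (2555123 , 266) ∷ (2704019 , 274) ∷
  (2861699 , 282) ∷ (3028811 , 290) ∷ (3205427 , 298) ∷ (3391907 , 307) ∷ (3589763 , 315) ∷ (3799067 , 325) ∷ (4020323 , 334) ∷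
  (4254683 , 343) ∷ (4502651 , 353) ∷ (4765451 , 363) ∷ (5043587 , 374) ∷ (5337923 , 385) ∷ (5648891 , 396) ∷ (5978723 , 407) ∷
  (6327707 , 419) ∷ (6696923 , 431) ∷ (7087667 , 443) ∷ (7501451 , 456) ∷ (7939499 , 469) ∷ (8402963 , 483) ∷ (8893427 , 497) ∷
  (9412691 , 511) ∷ (9962339 , 526) ∷ (10544099 , 541) ∷ (11159843 , 556) ∷ (11811299 , 572) ∷ (12499691 , 589) ∷ (13229627 , 606) ∷
  (14002187 , 623) ∷ (14819459 , 641) ∷ (15684611 , 660) ∷ (16600379 , 679) ∷ (17569427 , 698) ∷ (18595139 , 718) ∷ (19680467 , 739) ∷
  (20829443 , 760) ∷ (22045091 , 782) ∷ (23332523 , 805) ∷ (24695051 , 828) ∷ (26136707 , 852) ∷ (27662963 , 876) ∷ (29277923 , 901) ∷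
  (30987059 , 927) ∷ (32796131 , 954) ∷ (34710899 , 982) ∷ (36737699 , 1010) ∷ (38883011 , 1039) ∷ (41153603 , 1069) ∷ (43556603 , 1100) ∷
  (46100147 , 1131) ∷ (48792299 , 1164) ∷ (51641483 , 1197) ∷ (54657203 , 1232) ∷ (57849179 , 1267) ∷ (61226699 , 1304) ∷ (64801643 , 1341) ∷
  (68585963 , 1380) ∷ (72591179 , 1420) ∷ (76829891 , 1461) ∷ (81316283 , 1503) ∷ (86065043 , 1546) ∷ (91090859 , 1590) ∷ (96410291 , 1636) ∷
  (102040403 , 1683) ∷ (107999267 , 1732) ∷ (114305963 , 1782) ∷ (120980939 , 1833) ∷ (128045651 , 1886) ∷ (135523139 , 1940) ∷ (143435651 , 1996) ∷
  (151812131 , 2053) ∷ (160677779 , 2112) ∷ (170060603 , 2173) ∷ (179992139 , 2236) ∷ (190502483 , 2300) ∷ (201627779 , 2366) ∷ (213401723 , 2434) ∷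
  (225864131 , 2504) ∷ (239054531 , 2577) ∷ (253015043 , 2651) ∷ (267791099 , 2727) ∷ (283430003 , 2806) ∷ (299982299 , 2886) ∷ (317501123 , 2969) ∷
  (336042851 , 3055) ∷ (355667747 , 3143) ∷ (376438739 , 3233) ∷ (398422499 , 3326) ∷ (421690307 , 3422) ∷ (446316971 , 3521) ∷ (472380899 , 3622) ∷
  (499967771 , 3726) ∷ (529165499 , 3834) ∷ (560068547 , 3944) ∷ (592776419 , 4058) ∷ (627393803 , 4174) ∷ (664033091 , 4294) ∷ (702812507 , 4418) ∷
  (743856683 , 4545) ∷ (787297883 , 4676) ∷ (833275931 , 4811) ∷ (881938931 , 4949) ∷ (933444059 , 5092) ∷ (987956483 , 5238) ∷ (1045652891 , 5389) ∷
  (1106718611 , 5544) ∷ (1171350707 , 5704) ∷ (1239757403 , 5868) ∷ (1312158587 , 6037) ∷ (1388787251 , 6211) ∷ (1469892371 , 6390) ∷ (1555732931 , 6573) ∷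
  (1646587643 , 6763) ∷ (1742746883 , 6957) ∷ (1844522123 , 7158) ∷ (1952241539 , 7364) ∷ (2066251739 , 7576) ∷ (2186920643 , 7794) ∷ (2314636619 , 8018) ∷
  (2449810787 , 8249) ∷ (2592877739 , 8486) ∷ (2744301227 , 8731) ∷ (2904568259 , 8982) ∷ (3074194787 , 9241) ∷ (3253727003 , 9507) ∷ (3443744651 , 9780) ∷
  (3644859227 , 10062) ∷ (3857718731 , 10351) ∷ (4083009467 , 10649) ∷ (4321456907 , 10956) ∷ (4573829867 , 11271) ∷ (4840940651 , 11596) ∷ (5123650163 , 11930) ∷
  (5422871291 , 12273) ∷ (5739566891 , 12626) ∷ (6074757131 , 12990) ∷ (6429522299 , 13364) ∷ (6805006331 , 13748) ∷ (7202417819 , 14144) ∷ (7623038219 , 14551) ∷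
  (8068222931 , 14970) ∷ (8539407059 , 15401) ∷ (9038107787 , 15844) ∷ (9565933019 , 16301) ∷ (10124583323 , 16770) ∷ []

chain61 : Vec Entry 236
chain61 =
  (19501 , 23) ∷ (20509 , 24) ∷ (21661 , 24) ∷ (22741 , 25) ∷ (23893 , 25) ∷ (25261 , 26) ∷ (26701 , 27) ∷
  (28069 , 28) ∷ (29581 , 28) ∷ (31237 , 29) ∷ (33037 , 30) ∷ (34693 , 31) ∷ (36709 , 32) ∷ (38653 , 32) ∷
  (40813 , 33) ∷ (43189 , 34) ∷ (45061 , 35) ∷ (47653 , 36) ∷ (50101 , 37) ∷ (52981 , 38) ∷ (55933 , 39) ∷
  (59029 , 40) ∷ (62053 , 41) ∷ (65581 , 42) ∷ (69109 , 43) ∷ (73141 , 45) ∷ (77317 , 46) ∷ (81637 , 47) ∷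
  (86389 , 49) ∷ (91141 , 50) ∷ (96181 , 51) ∷ (101797 , 53) ∷ (107269 , 54) ∷ (113173 , 56) ∷ (119653 , 57) ∷
  (126493 , 59) ∷ (133261 , 61) ∷ (140893 , 62) ∷ (149101 , 64) ∷ (157669 , 66) ∷ (166741 , 68) ∷ (176461 , 70) ∷
  (186757 , 72) ∷ (197341 , 74) ∷ (208501 , 76) ∷ (220021 , 78) ∷ (232621 , 80) ∷ (245941 , 82) ∷ (260269 , 85) ∷
  (275461 , 87) ∷ (291373 , 90) ∷ (308293 , 92) ∷ (326149 , 95) ∷ (344941 , 98) ∷ (364669 , 100) ∷ (385837 , 103) ∷
  (408229 , 106) ∷ (431269 , 109) ∷ (456109 , 112) ∷ (482101 , 115) ∷ (510253 , 119) ∷ (539629 , 122) ∷ (571093 , 126) ∷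
  (604069 , 129) ∷ (638629 , 133) ∷ (675781 , 137) ∷ (715237 , 141) ∷ (756853 , 145) ∷ (800773 , 149) ∷ (847213 , 153) ∷
  (896677 , 157) ∷ (949021 , 162) ∷ (1004317 , 167) ∷ (1062781 , 171) ∷ (1124269 , 176) ∷ (1189789 , 181) ∷ (1259053 , 187) ∷
  (1332421 , 192) ∷ (1410109 , 198) ∷ (1492261 , 203) ∷ (1579381 , 209) ∷ (1670533 , 215) ∷ (1767877 , 221) ∷ (1870117 , 228) ∷
  (1979269 , 234) ∷ (2094109 , 241) ∷ (2215789 , 248) ∷ (2343949 , 255) ∷ (2480749 , 262) ∷ (2625613 , 270) ∷ (2778901 , 278) ∷
  (2939821 , 285) ∷ (3111397 , 294) ∷ (3292981 , 302) ∷ (3485077 , 311) ∷ (3688549 , 320) ∷ (3903901 , 329) ∷ (4131781 , 338) ∷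
  (4373053 , 348) ∷ (4627717 , 358) ∷ (4897933 , 369) ∷ (5183701 , 379) ∷ (5486389 , 390) ∷ (5806429 , 401) ∷ (6145261 , 413) ∷
  (6504109 , 425) ∷ (6883549 , 437) ∷ (7285237 , 450) ∷ (7710613 , 462) ∷ (8160613 , 476) ∷ (8636893 , 489) ∷ (9140893 , 504) ∷
  (9674701 , 518) ∷ (10239181 , 533) ∷ (10836421 , 548) ∷ (11469013 , 564) ∷ (12138613 , 580) ∷ (12847453 , 597) ∷ (13596613 , 614) ∷
  (14390269 , 632) ∷ (15230653 , 650) ∷ (16119781 , 669) ∷ (17060893 , 688) ∷ (18056869 , 708) ∷ (19111381 , 728) ∷ (20227237 , 749) ∷
  (21408397 , 771) ∷ (22658173 , 793) ∷ (23981389 , 816) ∷ (25381789 , 839) ∷ (26862973 , 863) ∷ (28431709 , 888) ∷ (30091813 , 914) ∷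
  (31849117 , 940) ∷ (33708949 , 967) ∷ (35677501 , 995) ∷ (37760677 , 1024) ∷ (39965173 , 1053) ∷ (42298621 , 1084) ∷ (44768653 , 1115) ∷
  (47383117 , 1147) ∷ (50149861 , 1180) ∷ (53078317 , 1214) ∷ (56178061 , 1249) ∷ (59458669 , 1285) ∷ (62930437 , 1322) ∷ (66604309 , 1360) ∷
  (70493893 , 1399) ∷ (74609701 , 1439) ∷ (78966709 , 1481) ∷ (83577517 , 1523) ∷ (88457389 , 1567) ∷ (93622813 , 1612) ∷ (99090133 , 1659) ∷
  (104876701 , 1706) ∷ (111001237 , 1756) ∷ (117483253 , 1806) ∷ (124344133 , 1858) ∷ (131605477 , 1912) ∷ (139291189 , 1967) ∷ (147425461 , 2023) ∷
  (156034933 , 2082) ∷ (165147181 , 2141) ∷ (174791653 , 2203) ∷ (184999237 , 2267) ∷ (195803053 , 2332) ∷ (207237949 , 2399) ∷ (219340357 , 2468) ∷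
  (232149013 , 2539) ∷ (245706469 , 2612) ∷ (260055637 , 2687) ∷ (275242381 , 2765) ∷ (291316309 , 2844) ∷ (308329117 , 2926) ∷ (326335453 , 3010) ∷
  (345392701 , 3097) ∷ (365563213 , 3186) ∷ (386911933 , 3278) ∷ (409506541 , 3372) ∷ (433421629 , 3469) ∷ (458733157 , 3569) ∷ (485523061 , 3672) ∷
  (513877093 , 3778) ∷ (543887413 , 3887) ∷ (575650357 , 3998) ∷ (609268021 , 4114) ∷ (644849053 , 4232) ∷ (682507429 , 4354) ∷ (722365621 , 4479) ∷
  (764550421 , 4608) ∷ (809200069 , 4741) ∷ (856457197 , 4877) ∷ (906473509 , 5018) ∷ (959410429 , 5162) ∷ (1015439533 , 5311) ∷ (1074741181 , 5464) ∷
  (1137505741 , 5621) ∷ (1203936037 , 5783) ∷ (1274245549 , 5949) ∷ (1348660933 , 6120) ∷ (1427421157 , 6297) ∷ (1510782109 , 6478) ∷ (1599011629 , 6664) ∷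
  (1692393541 , 6856) ∷ (1791228589 , 7053) ∷ (1895836309 , 7257) ∷ (2006552869 , 7465) ∷ (2123735101 , 7680) ∷ (2247761149 , 7901) ∷ (2379029533 , 8129) ∷
  (2517964549 , 8363) ∷ (2665013101 , 8604) ∷ (2820649813 , 8851) ∷ (2985375373 , 9106) ∷ (3159721069 , 9368) ∷ (3344248717 , 9638) ∷ (3539552173 , 9915) ∷
  (3746261509 , 10201) ∷ (3965042437 , 10494) ∷ (4196600341 , 10797) ∷ (4441681429 , 11107) ∷ (4701075541 , 11427) ∷ (4975618237 , 11756) ∷ (5266194253 , 12094) ∷
  (5573739949 , 12443) ∷ (5899246189 , 12801) ∷ (6243762013 , 13169) ∷ (6608397013 , 13548) ∷ (6994326301 , 13938) ∷ (7402794901 , 14340) ∷ (7835116741 , 14752) ∷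
  (8292687037 , 15177) ∷ (8776978621 , 15614) ∷ (9289554037 , 16063) ∷ (9832063957 , 16526) ∷ (10406256397 , 17002) ∷ []

chain65 : Vec Entry 237
chain65 =
  (19433 , 23) ∷ (20441 , 23) ∷ (21521 , 24) ∷ (21881 , 24) ∷ (22961 , 25) ∷ (24113 , 26) ∷ (25409 , 26) ∷
  (26849 , 27) ∷ (28289 , 28) ∷ (29873 , 28) ∷ (31601 , 29) ∷ (33329 , 30) ∷ (35201 , 31) ∷ (37217 , 32) ∷
  (39233 , 33) ∷ (41177 , 33) ∷ (43481 , 34) ∷ (45641 , 35) ∷ (48017 , 36) ∷ (50753 , 37) ∷ (53633 , 38) ∷
  (56369 , 39) ∷ (59393 , 40) ∷ (62633 , 41) ∷ (66161 , 43) ∷ (69833 , 44) ∷ (73721 , 45) ∷ (77969 , 46) ∷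
  (82361 , 47) ∷ (87041 , 49) ∷ (92009 , 50) ∷ (96401 , 51) ∷ (101873 , 53) ∷ (107777 , 54) ∷ (114041 , 56) ∷
  (120233 , 57) ∷ (127217 , 59) ∷ (134489 , 61) ∷ (142193 , 63) ∷ (150473 , 64) ∷ (159113 , 66) ∷ (167537 , 68) ∷
  (177257 , 70) ∷ (187409 , 72) ∷ (198281 , 74) ∷ (209801 , 76) ∷ (222041 , 78) ∷ (234713 , 80) ∷ (248177 , 83) ∷
  (262649 , 85) ∷ (276977 , 87) ∷ (292673 , 90) ∷ (309737 , 92) ∷ (327809 , 95) ∷ (346601 , 98) ∷ (366329 , 101) ∷
  (387641 , 103) ∷ (409961 , 106) ∷ (433577 , 109) ∷ (458849 , 113) ∷ (485417 , 116) ∷ (513641 , 119) ∷ (543593 , 123) ∷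
  (575129 , 126) ∷ (608609 , 130) ∷ (643961 , 133) ∷ (681257 , 137) ∷ (720857 , 141) ∷ (762761 , 145) ∷ (807113 , 149) ∷
  (854129 , 154) ∷ (903449 , 158) ∷ (955937 , 163) ∷ (1011737 , 167) ∷ (1070777 , 172) ∷ (1132697 , 177) ∷ (1198793 , 182) ∷
  (1268777 , 187) ∷ (1342433 , 193) ∷ (1420697 , 198) ∷ (1503353 , 204) ∷ (1589969 , 210) ∷ (1682561 , 216) ∷ (1780481 , 222) ∷
  (1883513 , 228) ∷ (1993457 , 235) ∷ (2109593 , 242) ∷ (2232569 , 249) ∷ (2362817 , 256) ∷ (2500769 , 263) ∷ (2646641 , 271) ∷
  (2800073 , 279) ∷ (2962793 , 287) ∷ (3135809 , 295) ∷ (3317537 , 303) ∷ (3511073 , 312) ∷ (3716057 , 321) ∷ (3932993 , 330) ∷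
  (4162313 , 340) ∷ (4405097 , 349) ∷ (4662209 , 360) ∷ (4934441 , 370) ∷ (5222297 , 381) ∷ (5527001 , 391) ∷ (5849633 , 403) ∷
  (6191201 , 414) ∷ (6552353 , 426) ∷ (6934817 , 439) ∷ (7339313 , 451) ∷ (7767569 , 464) ∷ (8220881 , 478) ∷ (8700833 , 491) ∷
  (9208937 , 505) ∷ (9746489 , 520) ∷ (10315577 , 535) ∷ (10917713 , 550) ∷ (11555273 , 566) ∷ (12229913 , 583) ∷ (12943793 , 599) ∷
  (13699649 , 617) ∷ (14498849 , 634) ∷ (15345569 , 653) ∷ (16241609 , 671) ∷ (17189849 , 691) ∷ (18193457 , 711) ∷ (19255241 , 731) ∷
  (20379521 , 752) ∷ (21569609 , 774) ∷ (22829033 , 796) ∷ (24162041 , 819) ∷ (25572377 , 842) ∷ (27065153 , 867) ∷ (28644617 , 892) ∷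
  (30317321 , 917) ∷ (32087441 , 944) ∷ (33961313 , 971) ∷ (35943833 , 999) ∷ (38042633 , 1028) ∷ (40263257 , 1057) ∷ (42614489 , 1088) ∷
  (45102881 , 1119) ∷ (47736281 , 1151) ∷ (50523761 , 1184) ∷ (53474321 , 1218) ∷ (56597033 , 1254) ∷ (59901689 , 1290) ∷ (63399881 , 1327) ∷
  (67102193 , 1365) ∷ (71018417 , 1404) ∷ (75165689 , 1445) ∷ (79555313 , 1486) ∷ (84201329 , 1529) ∷ (89118209 , 1573) ∷ (94322369 , 1618) ∷
  (99830729 , 1665) ∷ (105660713 , 1713) ∷ (111830969 , 1762) ∷ (118360721 , 1813) ∷ (125272361 , 1865) ∷ (132587993 , 1919) ∷ (140331089 , 1974) ∷
  (148526129 , 2031) ∷ (157200041 , 2089) ∷ (166380257 , 2149) ∷ (176095937 , 2211) ∷ (186379553 , 2275) ∷ (197263289 , 2341) ∷ (208783217 , 2408) ∷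
  (220976057 , 2477) ∷ (233881049 , 2549) ∷ (247539233 , 2622) ∷ (261994457 , 2697) ∷ (277294817 , 2775) ∷ (293488553 , 2855) ∷ (310628009 , 2937) ∷
  (328768409 , 3022) ∷ (347967857 , 3109) ∷ (368288201 , 3198) ∷ (389795537 , 3290) ∷ (412558481 , 3385) ∷ (436651841 , 3482) ∷ (462151721 , 3583) ∷
  (489141353 , 3686) ∷ (517706633 , 3792) ∷ (547940513 , 3901) ∷ (579939977 , 4013) ∷ (613808057 , 4129) ∷ (649654409 , 4248) ∷ (687593873 , 4370) ∷
  (727748993 , 4496) ∷ (770249009 , 4625) ∷ (815231513 , 4758) ∷ (862840793 , 4895) ∷ (913229201 , 5036) ∷ (966561257 , 5181) ∷ (1023008249 , 5330) ∷
  (1082751401 , 5484) ∷ (1145982953 , 5642) ∷ (1212908321 , 5804) ∷ (1283742137 , 5971) ∷ (1358712569 , 6143) ∷ (1438060601 , 6320) ∷ (1522043273 , 6502) ∷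
  (1610929937 , 6689) ∷ (1705008089 , 6882) ∷ (1804580417 , 7080) ∷ (1909967897 , 7284) ∷ (2021510009 , 7493) ∷ (2139565529 , 7709) ∷ (2264515193 , 7931) ∷
  (2396762057 , 8159) ∷ (2536732073 , 8394) ∷ (2684876969 , 8636) ∷ (2841673673 , 8884) ∷ (3007627121 , 9140) ∷ (3183271769 , 9403) ∷ (3369174401 , 9674) ∷
  (3565933769 , 9952) ∷ (3774184121 , 10239) ∷ (3994595993 , 10533) ∷ (4227880169 , 10837) ∷ (4474787897 , 11149) ∷ (4736115353 , 11470) ∷ (5012703281 , 11800) ∷
  (5305444913 , 12139) ∷ (5615282657 , 12489) ∷ (5943215009 , 12848) ∷ (6290298569 , 13218) ∷ (6657650849 , 13599) ∷ (7046457329 , 13990) ∷ (7457970017 , 14393) ∷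
  (7893514649 , 14807) ∷ (8354495729 , 15233) ∷ (8842397537 , 15672) ∷ (9358793417 , 16123) ∷ (9905346929 , 16587) ∷ (10483818833 , 17065) ∷ []

chain67 : Vec Entry 237
chain67 =
  (19507 , 23) ∷ (20443 , 23) ∷ (21523 , 24) ∷ (22531 , 25) ∷ (23827 , 25) ∷ (24979 , 26) ∷ (26347 , 27) ∷
  (27427 , 27) ∷ (28867 , 28) ∷ (30307 , 29) ∷ (31963 , 29) ∷ (33619 , 30) ∷ (35491 , 31) ∷ (37507 , 32) ∷
  (39667 , 33) ∷ (41611 , 34) ∷ (43987 , 35) ∷ (46507 , 36) ∷ (49171 , 37) ∷ (51907 , 38) ∷ (54787 , 39) ∷
  (57667 , 40) ∷ (60763 , 41) ∷ (63499 , 42) ∷ (66883 , 43) ∷ (70627 , 44) ∷ (74731 , 45) ∷ (78979 , 47) ∷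
  (83443 , 48) ∷ (87691 , 49) ∷ (92227 , 50) ∷ (96979 , 52) ∷ (102523 , 53) ∷ (108499 , 55) ∷ (114691 , 56) ∷
  (121171 , 58) ∷ (127867 , 59) ∷ (135283 , 61) ∷ (142771 , 63) ∷ (151051 , 64) ∷ (159763 , 66) ∷ (168331 , 68) ∷
  (177979 , 70) ∷ (187987 , 72) ∷ (198859 , 74) ∷ (210019 , 76) ∷ (222043 , 78) ∷ (235003 , 80) ∷ (248683 , 83) ∷
  (263083 , 85) ∷ (278347 , 88) ∷ (294403 , 90) ∷ (311539 , 93) ∷ (329683 , 95) ∷ (348763 , 98) ∷ (369067 , 101) ∷
  (390307 , 104) ∷ (412987 , 107) ∷ (436963 , 110) ∷ (462307 , 113) ∷ (489019 , 116) ∷ (517459 , 120) ∷ (547627 , 123) ∷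
  (579451 , 127) ∷ (613219 , 130) ∷ (648931 , 134) ∷ (686731 , 138) ∷ (726619 , 142) ∷ (768811 , 146) ∷ (813091 , 150) ∷
  (860323 , 154) ∷ (910219 , 159) ∷ (963283 , 163) ∷ (1019443 , 168) ∷ (1078699 , 173) ∷ (1141267 , 178) ∷ (1207363 , 183) ∷
  (1277491 , 188) ∷ (1351291 , 193) ∷ (1430131 , 199) ∷ (1513219 , 205) ∷ (1601563 , 211) ∷ (1695091 , 217) ∷ (1793947 , 223) ∷
  (1898563 , 229) ∷ (2009299 , 236) ∷ (2126587 , 243) ∷ (2249419 , 250) ∷ (2380531 , 257) ∷ (2519347 , 264) ∷ (2666227 , 272) ∷
  (2821459 , 280) ∷ (2985979 , 288) ∷ (3160291 , 296) ∷ (3344827 , 304) ∷ (3539659 , 313) ∷ (3746299 , 322) ∷ (3964963 , 332) ∷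
  (4196371 , 341) ∷ (4441387 , 351) ∷ (4700659 , 361) ∷ (4974691 , 371) ∷ (5265067 , 382) ∷ (5572507 , 393) ∷ (5897443 , 404) ∷
  (6241603 , 416) ∷ (6605563 , 428) ∷ (6990691 , 440) ∷ (7398931 , 453) ∷ (7830283 , 466) ∷ (8287339 , 479) ∷ (8771107 , 493) ∷
  (9283171 , 507) ∷ (9825187 , 522) ∷ (10398811 , 537) ∷ (11005843 , 553) ∷ (11647939 , 568) ∷ (12328051 , 585) ∷ (13047763 , 602) ∷
  (13809667 , 619) ∷ (14616139 , 637) ∷ (15469339 , 655) ∷ (16372579 , 674) ∷ (17328523 , 693) ∷ (18340411 , 713) ∷ (19411267 , 734) ∷
  (20544763 , 755) ∷ (21744571 , 777) ∷ (23014291 , 799) ∷ (24358027 , 822) ∷ (25779739 , 846) ∷ (27284827 , 870) ∷ (28877971 , 895) ∷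
  (30564139 , 921) ∷ (32348947 , 948) ∷ (34237939 , 975) ∷ (36236803 , 1003) ∷ (38352883 , 1032) ∷ (40592659 , 1062) ∷ (42962539 , 1092) ∷
  (45471163 , 1124) ∷ (48126667 , 1156) ∷ (50936971 , 1189) ∷ (53910931 , 1223) ∷ (57059203 , 1259) ∷ (60390931 , 1295) ∷ (63917563 , 1332) ∷
  (67650043 , 1370) ∷ (71600611 , 1410) ∷ (75781723 , 1451) ∷ (80206843 , 1492) ∷ (84890731 , 1535) ∷ (89848147 , 1579) ∷ (95095219 , 1625) ∷
  (100648579 , 1672) ∷ (106526443 , 1720) ∷ (112746811 , 1769) ∷ (119331139 , 1820) ∷ (126299947 , 1873) ∷ (133675411 , 1927) ∷ (141481723 , 1982) ∷
  (149744083 , 2039) ∷ (158489131 , 2098) ∷ (167744587 , 2158) ∷ (177540043 , 2220) ∷ (187907971 , 2284) ∷ (198881779 , 2350) ∷ (210495739 , 2418) ∷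
  (222788443 , 2487) ∷ (235799131 , 2559) ∷ (249568339 , 2633) ∷ (264142939 , 2708) ∷ (279568579 , 2786) ∷ (295895011 , 2867) ∷ (313175227 , 2949) ∷
  (331464379 , 3034) ∷ (350821291 , 3121) ∷ (371308243 , 3211) ∷ (392992267 , 3304) ∷ (415942987 , 3399) ∷ (440233051 , 3497) ∷ (465942523 , 3597) ∷
  (493153411 , 3701) ∷ (521952979 , 3807) ∷ (552434611 , 3917) ∷ (584696659 , 4030) ∷ (618842659 , 4146) ∷ (654982267 , 4265) ∷ (693233131 , 4388) ∷
  (733717651 , 4514) ∷ (776566507 , 4644) ∷ (821917651 , 4778) ∷ (869917099 , 4915) ∷ (920720011 , 5057) ∷ (974489899 , 5202) ∷ (1031400067 , 5352) ∷
  (1091633251 , 5506) ∷ (1155383059 , 5665) ∷ (1222856923 , 5828) ∷ (1294271059 , 5996) ∷ (1369854931 , 6168) ∷ (1449853411 , 6346) ∷ (1534524403 , 6529) ∷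
  (1624139851 , 6716) ∷ (1718989267 , 6910) ∷ (1819378147 , 7109) ∷ (1925629267 , 7313) ∷ (2038085779 , 7524) ∷ (2157109483 , 7740) ∷ (2283084571 , 7963) ∷
  (2416416403 , 8193) ∷ (2557533523 , 8428) ∷ (2706893131 , 8671) ∷ (2864975107 , 8921) ∷ (3032289427 , 9177) ∷ (3209374939 , 9442) ∷ (3396802027 , 9713) ∷
  (3595175131 , 9993) ∷ (3805132963 , 10281) ∷ (4027352611 , 10577) ∷ (4262549971 , 10881) ∷ (4511482267 , 11194) ∷ (4774951651 , 11517) ∷ (5053808731 , 11848) ∷
  (5348951131 , 12189) ∷ (5661329827 , 12540) ∷ (5991950803 , 12901) ∷ (6341880163 , 13272) ∷ (6712245931 , 13654) ∷ (7104241003 , 14047) ∷ (7519127683 , 14452) ∷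
  (7958243947 , 14868) ∷ (8423005243 , 15296) ∷ (8914908451 , 15736) ∷ (9435539083 , 16189) ∷ (9986573659 , 16655) ∷ (10569788707 , 17135) ∷ []

chain71 : Vec Entry 237
chain71 =
  (19079 , 23) ∷ (19727 , 23) ∷ (20879 , 24) ∷ (22031 , 24) ∷ (23039 , 25) ∷ (23831 , 25) ∷ (25127 , 26) ∷
  (26423 , 27) ∷ (27791 , 27) ∷ (29303 , 28) ∷ (30671 , 29) ∷ (32327 , 30) ∷ (34127 , 30) ∷ (35999 , 31) ∷
  (37871 , 32) ∷ (40031 , 33) ∷ (41903 , 34) ∷ (44279 , 35) ∷ (46727 , 36) ∷ (49391 , 37) ∷ (52127 , 38) ∷
  (55079 , 39) ∷ (58031 , 40) ∷ (61343 , 41) ∷ (64871 , 42) ∷ (68543 , 43) ∷ (72503 , 45) ∷ (76679 , 46) ∷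
  (81071 , 47) ∷ (85751 , 48) ∷ (90647 , 50) ∷ (95471 , 51) ∷ (100943 , 53) ∷ (106703 , 54) ∷ (112247 , 56) ∷
  (118799 , 57) ∷ (125711 , 59) ∷ (132911 , 60) ∷ (140111 , 62) ∷ (147743 , 64) ∷ (155663 , 65) ∷ (164663 , 67) ∷
  (173807 , 69) ∷ (183527 , 71) ∷ (193751 , 73) ∷ (204983 , 75) ∷ (216791 , 77) ∷ (229247 , 79) ∷ (242279 , 82) ∷
  (256391 , 84) ∷ (271079 , 86) ∷ (286703 , 89) ∷ (303119 , 91) ∷ (320759 , 94) ∷ (339263 , 97) ∷ (359063 , 100) ∷
  (379727 , 102) ∷ (401903 , 105) ∷ (424727 , 108) ∷ (448703 , 111) ∷ (474839 , 115) ∷ (502487 , 118) ∷ (531359 , 121) ∷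
  (562103 , 125) ∷ (594359 , 128) ∷ (628487 , 132) ∷ (664847 , 136) ∷ (703223 , 139) ∷ (743111 , 143) ∷ (786311 , 147) ∷
  (832103 , 152) ∷ (880559 , 156) ∷ (931967 , 161) ∷ (985679 , 165) ∷ (1042703 , 170) ∷ (1103183 , 175) ∷ (1166903 , 180) ∷
  (1234799 , 185) ∷ (1306439 , 190) ∷ (1382543 , 196) ∷ (1463183 , 201) ∷ (1548359 , 207) ∷ (1638719 , 213) ∷ (1733903 , 219) ∷
  (1834991 , 225) ∷ (1941983 , 232) ∷ (2055311 , 239) ∷ (2175263 , 245) ∷ (2301623 , 253) ∷ (2435903 , 260) ∷ (2578031 , 267) ∷
  (2728079 , 275) ∷ (2886911 , 283) ∷ (3055319 , 291) ∷ (3233663 , 299) ∷ (3422303 , 308) ∷ (3621887 , 317) ∷ (3832919 , 326) ∷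
  (4056623 , 335) ∷ (4293071 , 345) ∷ (4543703 , 355) ∷ (4809023 , 365) ∷ (5089751 , 376) ∷ (5386967 , 386) ∷ (5701391 , 398) ∷
  (6034247 , 409) ∷ (6386327 , 421) ∷ (6758567 , 433) ∷ (7153199 , 445) ∷ (7570583 , 458) ∷ (8012519 , 471) ∷ (8480447 , 485) ∷
  (8975159 , 499) ∷ (9498959 , 513) ∷ (10053431 , 528) ∷ (10640159 , 543) ∷ (11261519 , 559) ∷ (11918519 , 575) ∷ (12613823 , 592) ∷
  (13350383 , 609) ∷ (14129783 , 626) ∷ (14953823 , 644) ∷ (15827111 , 663) ∷ (16750583 , 682) ∷ (17728703 , 701) ∷ (18763991 , 722) ∷
  (19859759 , 742) ∷ (21019247 , 764) ∷ (22246487 , 786) ∷ (23545367 , 808) ∷ (24920279 , 832) ∷ (26374391 , 856) ∷ (27913967 , 880) ∷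
  (29543543 , 906) ∷ (31268807 , 932) ∷ (33094871 , 958) ∷ (35027423 , 986) ∷ (37072943 , 1014) ∷ (39237767 , 1044) ∷ (41529239 , 1074) ∷
  (43954271 , 1105) ∷ (46521143 , 1136) ∷ (49237631 , 1169) ∷ (52113023 , 1203) ∷ (55156319 , 1237) ∷ (58376951 , 1273) ∷ (61786079 , 1310) ∷
  (65393711 , 1347) ∷ (69212519 , 1386) ∷ (73254239 , 1426) ∷ (77532263 , 1467) ∷ (82060127 , 1509) ∷ (86852159 , 1553) ∷ (91924271 , 1598) ∷
  (97292087 , 1644) ∷ (102973823 , 1691) ∷ (108986183 , 1740) ∷ (115350551 , 1790) ∷ (122086583 , 1841) ∷ (129215591 , 1894) ∷ (136761623 , 1949) ∷
  (144748151 , 2005) ∷ (153201311 , 2063) ∷ (162147383 , 2122) ∷ (171616463 , 2183) ∷ (181638647 , 2246) ∷ (192245399 , 2311) ∷ (203472359 , 2377) ∷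
  (215354663 , 2445) ∷ (227929679 , 2516) ∷ (241240751 , 2588) ∷ (255327911 , 2663) ∷ (270238607 , 2739) ∷ (286020071 , 2818) ∷ (302723279 , 2899) ∷
  (320402231 , 2983) ∷ (339113447 , 3069) ∷ (358917623 , 3157) ∷ (379878119 , 3248) ∷ (402062327 , 3342) ∷ (425541167 , 3438) ∷ (450392471 , 3537) ∷
  (476695367 , 3639) ∷ (504533951 , 3743) ∷ (533998727 , 3851) ∷ (565183943 , 3962) ∷ (598190399 , 4076) ∷ (633124367 , 4193) ∷ (670098311 , 4314) ∷
  (709232039 , 4438) ∷ (750651047 , 4566) ∷ (794487887 , 4697) ∷ (840885119 , 4833) ∷ (889992503 , 4972) ∷ (941967431 , 5115) ∷ (996978239 , 5262) ∷
  (1055201687 , 5414) ∷ (1116824831 , 5569) ∷ (1182047327 , 5730) ∷ (1251078119 , 5895) ∷ (1324140263 , 6064) ∷ (1401469703 , 6239) ∷ (1483314479 , 6419) ∷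
  (1569939407 , 6603) ∷ (1661623703 , 6794) ∷ (1758662351 , 6989) ∷ (1861367831 , 7190) ∷ (1970071343 , 7397) ∷ (2085122807 , 7610) ∷ (2206893959 , 7829) ∷
  (2335775903 , 8055) ∷ (2472184511 , 8287) ∷ (2616559487 , 8525) ∷ (2769366311 , 8770) ∷ (2931096743 , 9023) ∷ (3102272783 , 9283) ∷ (3283445159 , 9550) ∷
  (3475196927 , 9825) ∷ (3678148367 , 10108) ∷ (3892952159 , 10399) ∷ (4120300511 , 10698) ∷ (4360924727 , 11006) ∷ (4615602623 , 11323) ∷ (4885153487 , 11649) ∷
  (5170445711 , 11984) ∷ (5472399311 , 12329) ∷ (5791987367 , 12684) ∷ (6130239407 , 13049) ∷ (6488244647 , 13425) ∷ (6867157751 , 13811) ∷ (7268198543 , 14209) ∷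
  (7692660719 , 14618) ∷ (8141912063 , 15038) ∷ (8617399559 , 15471) ∷ (9120655079 , 15917) ∷ (9653301143 , 16375) ∷ (10217053799 , 16846) ∷ []

table : List (ℕ × ChainCertificate)
table =
  (1 , -, chain1) ∷
  (5 , -, chain5) ∷
  (7 , -, chain7) ∷
  (11 , -, chain11) ∷
  (13 , -, chain13) ∷
  (17 , -, chain17) ∷
  (19 , -, chain19) ∷
  (23 , -, chain23) ∷
  (25 , -, chain25) ∷
  (29 , -, chain29) ∷
  (31 , -, chain31) ∷
  (35 , -, chain35) ∷
  (37 , -, chain37) ∷
  (41 , -, chain41) ∷
  (43 , -, chain43) ∷
  (47 , -, chain47) ∷
  (49 , -, chain49) ∷
  (53 , -, chain53) ∷
  (55 , -, chain55) ∷
  (59 , -, chain59) ∷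
  (61 , -, chain61) ∷
  (65 , -, chain65) ∷
  (67 , -, chain67) ∷
  (71 , -, chain71) ∷ []

-- Every chain in the table is valid for its residue (checked by evaluation;
-- this is where all the primality certificates are run).
tableValid : ListAll.All (λ (r , c) → Valid r c) table
tableValid = from-yes (ListAll.all? (λ (r , c) → valid? r c) table)

UnitListed : ℕ → Set
UnitListed r = Coprime r 72 → Any ((r ≡_) ∘ proj₁) table

unitListed? : Decidable UnitListed
unitListed? r = coprime? r 72 →-dec any? ((r ≟_) ∘ proj₁) table

allUnitsListed : ∀ (i : Fin 72) → UnitListed (toℕ i)
allUnitsListed = from-yes (all? {n = 72} (unitListed? ∘ toℕ))

unitsListed : ∀ r → r < 72 → UnitListed r
unitsListed r r<72 = subst UnitListed (toℕ-fromℕ< r<72) (allUnitsListed (fromℕ< r<72))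

validChainFor : ∀ r → r < 72 → Coprime r 72 → Σ ChainCertificate (Valid r)
validChainFor r r<72 r⊥72 =
  let listed = unitsListed r r<72 r⊥72
      _ , chain = Any.lookup listed
      valid , r≡s = ListAll.lookupAny tableValid listed
  in chain , subst (λ s → Valid s chain) (sym r≡s) valid

mainTheorem6 : (l : ℕ) → Coprime l 72 →
    Σ ℕ λ M → Σ (Fin (suc M) → ℕ) λ p →
    PrimeChain l M p × (p zero < 19541) × (p (fromℕ M) > 10 ^ 10)
mainTheorem6 l l⊥72 =
  let (M , v) , entries , steps , start , end =
        validChainFor (l % 72) (m%n<n l 72) (coprime-% l⊥72)
  in M , (λ i → proj₁ (lookup v i)) , certified⇒PrimeChain l entries steps , start , end
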